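{- Let $l,m,n,s$ be nonnegative integers such that $m\ge1$, $n\ge3$ is odd, and if $m$ is odd then $m\ge n$. Let $G=(T_1(w_1),T_2(w_2),\dots,T_m(w_m))$ be a unicyclic graph with a cycle of length $m$, and let $D_1$ be an oriented graph obtained from $G$ by considering a strong orientation of its cycle (other edges oriented arbitrarily). Let $C_n^+$ be a strongly oriented cycle on an $n$-element vertex set and $C_n^-$ its reverse on the same vertex set. Assume that $(a_0^l,a_1^l,\dots,a_l^l)$ is any sequence of nonnegative integers such that $a_0^0=n$ when $l=0$, and, when $l\ge1$, $$\sum_{i=0}^l\frac{a_i^l}{n^{l-i}}=n\quad\text{and}\quad\sum_{i=0}^k\frac{a_i^l}{n^{k-i+1}}\in\mathbb{Z}^+\ \text{ for each } k=0,1,\dots,l-1.$$ Then there exist a sequence of digraphs $D_i$ and a sequence of functions $h_i:E(D_i)\to\{C_n^+,C_n^-\}$, $i=1,\dots,l+s+1$, such that $D_{i+1}=D_i\otimes_{h_i}\{C_n^+,C_n^-\}$, $$G^{n^s}\cong\mathrm{und}(D_{s+1})\quad\text{and}\quad\sum_{i=0}^l a_i^l\,G^{n^{s+i}}\cong\mathrm{und}(D_{l+s+2}).$$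
   Context: Notation: for trees $T_1,\dots,T_m$ and $w_j\in V(T_j)$, $(T_1(w_1),\dots,T_m(w_m))$ is the unicyclic graph obtained from a cycle $a_1\cdots a_m$ and disjoint copies of the $T_j$ by identifying $w_j$ with $a_j$. For $G=(T_1(w_1),\dots,T_m(w_m))$ and $k\ge1$, $G^k$ denotes $(T_1(w_1),\dots,T_m(w_m),\dots,T_1(w_1),\dots,T_m(w_m))$ with the block of $m$ entries repeated $k$ times (a unicyclic graph with cycle of length $mk$). $aH$ denotes $a$ disjoint copies of $H$ and the sum is disjoint union. Product: for a digraph $D$, a family $\Gamma$ of digraphs with common vertex set $V$ and $h:E(D)\to\Gamma$, $D\otimes_h\Gamma$ has vertex set $V(D)\times V$ and $((a,x),(b,y))$ is an arc iff $(a,b)\in E(D)$ and $(x,y)\in E(h(a,b))$. $\mathrm{und}$ is underlying graph. $\mathbb{Z}^+$ denotes the positive integers. -}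

module Defs where

open import Data.Nat using (ℕ; zero; suc; _+_; _*_; _∸_; _^_; NonZero)
open import Data.Nat.Properties using (m^n≢0)
open import Data.Fin using (Fin; toℕ; remainder)
open import Data.Bool using (Bool; true; false)
open import Data.Product using (Σ; _×_; _,_; proj₁; proj₂)
open import Data.Sum using (_⊎_)
open import Data.Empty using (⊥)
open import Data.Integer using (+_)
open import Data.Rational using (ℚ; _/_; 0ℚ) renaming (_+_ to _+ℚ_)
open import Function.Definitions using (Injective)
open import Function.Bundles using (_↔_; _⇔_; Inverse)
open import Relation.Binary.PropositionalEquality using (_≡_)
open import Relation.Nullary using (¬_)

-- Graphs and digraphs (vertex sets are arbitrary types; all graphs
-- occurring in the theorem are built from finite data, hence finite)

record Graph : Set₁ where
  field
    V   : Set
    Adj : V → V → Set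

record Digraph : Set₁ where
  field
    V   : Set
    Arc : V → V → Set

open Graph
open Digraph

und : Digraph → Graph
und D = record { V = V D ; Adj = λ x y → Arc D x y ⊎ Arc D y x }

_≅_ : Graph → Graph → Set
G ≅ H = Σ (V G ↔ V H) λ f →
  ∀ x y → Adj G x y ⇔ Adj H (Inverse.to f x) (Inverse.to f y)

DisjUnion : (I : Set) → (I → Graph) → Graph
DisjUnion I H = record
  { V   = Σ I (λ i → V (H i))
  ; Adj = λ p q → Σ (proj₁ p ≡ proj₁ q) λ e → AdjOver e (proj₂ p) (proj₂ q) }
  where
  AdjOver : ∀ {i j} → i ≡ j → V (H i) → V (H j) → Set
  AdjOver {i} Relation.Binary.PropositionalEquality.refl x y = Adj (H i) x y

CycArc : (N : ℕ) → Fin N → Fin N → Set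
CycArc N i j = (suc (toℕ i) ≡ toℕ j) ⊎ ((suc (toℕ i) ≡ N) × (toℕ j ≡ 0))

CycDir : (N : ℕ) → Bool → Fin N → Fin N → Set
CycDir N true  i j = CycArc N i j
CycDir N false i j = CycArc N j i

CycAdj : (N : ℕ) → Fin N → Fin N → Set
CycAdj N i j = CycArc N i j ⊎ CycArc N j i

data Walk {k : ℕ} (A : Fin k → Fin k → Set) : Fin k → Fin k → Set where
  here : ∀ x → Walk A x x
  step : ∀ {x y z} → A x y → Walk A y z → Walk A x z

HasCycle : {k : ℕ} → (Fin k → Fin k → Set) → Set
HasCycle {k} A = Σ ℕ λ r → Σ (Fin (3 + r) → Fin k) λ c →
  Injective _≡_ _≡_ c × (∀ i j → CycArc (3 + r) i j → A (c i) (c j))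

record RootedTree : Set₁ where
  field
    size      : ℕ
    TAdj      : Fin size → Fin size → Set
    symmetric : ∀ x y → TAdj x y → TAdj y x
    irreflex  : ∀ x → ¬ TAdj x x
    connected : ∀ x y → Walk TAdj x y
    acyclic   : ¬ HasCycle TAdj
    root      : Fin size

open RootedTree

record Orientation (T : RootedTree) : Set₁ where
  field
    O       : Fin (size T) → Fin (size T) → Set
    sound   : ∀ x y → O x y → TAdj T x y
    covers  : ∀ x y → TAdj T x y → O x y ⊎ O y x
    antisym : ∀ x y → O x y → ¬ O y x

open Orientation

-- Unicyclic graph (T_1(w_1), ..., T_N(w_N)) : cycle a_1 ... a_N with
-- a_j identified with the root w_j of a copy of T_j

UVert : (N : ℕ) → (Fin N → RootedTree) → Set
UVert N T = Σ (Fin N) (λ j → Fin (size (T j)))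

data UAdj (N : ℕ) (T : Fin N → RootedTree) : UVert N T → UVert N T → Set where
  tree : ∀ j x y → TAdj (T j) x y → UAdj N T (j , x) (j , y)
  cyc  : ∀ j j' → CycAdj N j j' → UAdj N T (j , root (T j)) (j' , root (T j'))

Unicyclic : (N : ℕ) → (Fin N → RootedTree) → Graph
Unicyclic N T = record { V = UVert N T ; Adj = UAdj N T }

-- G^k for G = (T_1(w_1),...,T_m(w_m)) : the block repeated k times,
-- cycle of length k * m, position i carries T_(i mod m)
UPow : (m : ℕ) → (Fin m → RootedTree) → (k : ℕ) → Graph
UPow m T k = Unicyclic (k * m) (λ i → T (remainder {k} m i))

data D1Arc (m : ℕ) (T : Fin m → RootedTree) (O : (j : Fin m) → Orientation (T j))
           (dir : Bool) : UVert m T → UVert m T → Set where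
  tree : ∀ j x y → Orientation.O (O j) x y → D1Arc m T O dir (j , x) (j , y)
  cyc  : ∀ j j' → CycDir m dir j j' →
         D1Arc m T O dir (j , root (T j)) (j' , root (T j'))

D1 : (m : ℕ) (T : Fin m → RootedTree) → ((j : Fin m) → Orientation (T j)) → Bool → Digraph
D1 m T O dir = record { V = UVert m T ; Arc = D1Arc m T O dir }

Cn : (n : ℕ) → Bool → Digraph
Cn n b = record { V = Fin n ; Arc = CycDir n b }

Labeling : Digraph → Set
Labeling D = (a b : V D) → Arc D a b → Bool

prod : (n : ℕ) (D : Digraph) → Labeling D → Digraph
prod n D h = record
  { V   = V D × Fin n
  ; Arc = λ p q → Σ (Arc D (proj₁ p) (proj₁ q)) λ e →
                    Arc (Cn n (h (proj₁ p) (proj₁ q) e)) (proj₂ p) (proj₂ q) }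

Labelings : (n : ℕ) → ℕ → Digraph → Set
Labelings n zero    D = Data.Unit.⊤ where import Data.Unit
Labelings n (suc r) D = Σ (Labeling D) λ h → Labelings n r (prod n D h)

-- stage n r D hs i = D_{i+1} (for i ≤ r), where D_1 = D
stage : (n r : ℕ) (D : Digraph) → Labelings n r D → ℕ → Digraph
stage n zero    D hs       i       = D
stage n (suc r) D (h , hs) zero    = D
stage n (suc r) D (h , hs) (suc i) = stage n r (prod n D h) hs i

divPow : (a n e : ℕ) → .{{NonZero n}} → ℚ
divPow a n e = _/_ (+ a) (n ^ e) {{m^n≢0 n e}}

Σq : ℕ → (ℕ → ℚ) → ℚ
Σq zero    f = 0ℚ
Σq (suc k) f = Σq k f +ℚ f k

-- D ⊗_h {C_n^+, C_n^-} is the derived graph of D for the voltages ±1 in ℤ/n: an arc u → v labelled b lifts to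
-- the arcs (u, q) → (v, q ± 1). Recoordinatising each fibre by q ↦ h·q + s(u), h a unit, turns the voltage σ
-- into σ·h + s(v) − s(u). Trees are bipartite (an odd closed walk contains a cycle), so on a unicyclic digraph
-- the labels and s, built from a 2-colouring of the trees and the heights of the labels along the cycle, can be
-- chosen so that every voltage vanishes except on the arc closing the cycle, which carries the winding number w.
-- If w is a unit mod n the derived graph is the unicyclic digraph with an n times longer cycle (G^k becomes
-- G^{kn}); if w ≡ 0 it is n disjoint copies. A cycle of length L realises every w ≡ L mod 2 with |w| ≤ L: a
-- unit (1 or 2, as n is odd) always, and 0 when L is even or L ≥ n.
--
-- The sum hypotheses say that q_k = Σ_{i<k} a_i / n^{k-i} are integers with q_0 = 0, a_l + q_l = n and
-- n·q_{i+1} = a_i + q_i. So grow s times to G^{n^s} and split once into a_l + q_l copies; then for i = l, …, 1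
-- one step grows the a_i copies together with all copies grown before, and splits the q_i others into
-- n·q_i = a_{i-1} + q_{i-1} copies. In the end a_i copies have grown i times, giving G^{n^{s+i}}.

module Submission where

open import Defs

module Congruences where

  open import Data.Nat as ℕ using (ℕ; zero; suc; NonZero)
  import Data.Nat.Properties as ℕP
  import Data.Nat.Divisibility as ℕ∣
  open import Data.Integer using (ℤ; +_; -[1+_]; _+_; _*_; -_; _-_; _⊖_; ∣_∣)
  import Data.Integer.Properties as ℤP
  open import Data.Integer.DivMod using (_%ℕ_; _/ℕ_; n%ℕd<d; a≡a%ℕn+[a/ℕn]*n)
  open import Data.Integer.Divisibility.Signed
    using (_∣_; divides; ∣m∣n⇒∣m+n; ∣m⇒∣-m; ∣m⇒∣m*n; ∣⇒∣ᵤ)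
  open import Data.Integer.Tactic.RingSolver using (solve-∀)
  open import Data.Fin using (Fin; toℕ; fromℕ<)
  import Data.Fin.Properties as FP
  open import Data.Bool using (Bool; true; false; not)
  open import Data.Product using (_,_)
  open import Data.Sum using (inj₁; inj₂)
  open import Function using (_$_)
  open import Function.Bundles using (_⇔_; mk⇔; Equivalence)
  open import Relation.Binary.Bundles using (Setoid)
  import Relation.Binary.Reasoning.Setoid as SetoidReasoning
  open import Relation.Binary.PropositionalEquality
  open import Relation.Nullary using (contradiction)

  sign : Bool → ℤ
  sign true  = + 1
  sign false = -[1+ 0 ]

  sign-not : ∀ b → sign (not b) ≡ - sign b
  sign-not true  = refl
  sign-not false = refl

  module Modulo (n : ℕ) .{{_ : NonZero n}} where

    -- A record rather than a definition, so that a and b can be inferred from a proof.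
    infix 4 _≡ₙ_
    record _≡ₙ_ (a b : ℤ) : Set where
      constructor mod
      field divides-difference : + n ∣ a - b

    private
      by-identity : ∀ {c d x} → c - d ≡ x → + n ∣ x → c ≡ₙ d
      by-identity e d = mod (subst (+ n ∣_) (sym e) d)

    ≡ₙ-reflexive : ∀ {a b} → a ≡ b → a ≡ₙ b
    ≡ₙ-reflexive {a} refl = mod (divides (+ 0) (ℤP.+-inverseʳ a))

    ≡ₙ-refl : ∀ {a} → a ≡ₙ a
    ≡ₙ-refl = ≡ₙ-reflexive refl

    ≡ₙ-sym : ∀ {a b} → a ≡ₙ b → b ≡ₙ a
    ≡ₙ-sym {a} {b} (mod d) = by-identity (identity a b) (∣m⇒∣-m d)
      where
      identity : ∀ a b → b - a ≡ - (a - b)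
      identity = solve-∀

    ≡ₙ-trans : ∀ {a b c} → a ≡ₙ b → b ≡ₙ c → a ≡ₙ c
    ≡ₙ-trans {a} {b} {c} (mod d) (mod e) = by-identity (identity a b c) (∣m∣n⇒∣m+n d e)
      where
      identity : ∀ a b c → a - c ≡ (a - b) + (b - c)
      identity = solve-∀

    ≡ₙ-setoid : Setoid _ _
    ≡ₙ-setoid = record
      { Carrier = ℤ ; _≈_ = _≡ₙ_
      ; isEquivalence = record { refl = ≡ₙ-refl ; sym = ≡ₙ-sym ; trans = ≡ₙ-trans } }

    module ≡ₙ-Reasoning = SetoidReasoning ≡ₙ-setoid

    +-cong-≡ₙ : ∀ {a b c d} → a ≡ₙ b → c ≡ₙ d → a + c ≡ₙ b + d
    +-cong-≡ₙ {a} {b} {c} {d} (mod e) (mod f) = by-identity (identity a b c d) (∣m∣n⇒∣m+n e f)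
      where
      identity : ∀ a b c d → (a + c) - (b + d) ≡ (a - b) + (c - d)
      identity = solve-∀

    *-congʳ-≡ₙ : ∀ {a b} c → a ≡ₙ b → a * c ≡ₙ b * c
    *-congʳ-≡ₙ {a} {b} c (mod e) = by-identity (identity a b c) (∣m⇒∣m*n c e)
      where
      identity : ∀ a b c → a * c - b * c ≡ (a - b) * c
      identity = solve-∀

    *-congˡ-≡ₙ : ∀ c {a b} → a ≡ₙ b → c * a ≡ₙ c * b
    *-congˡ-≡ₙ c {a} {b} e = subst₂ _≡ₙ_ (ℤP.*-comm a c) (ℤP.*-comm b c) (*-congʳ-≡ₙ c e)

    n≡ₙ0 : + n ≡ₙ + 0
    n≡ₙ0 = mod $ divides (+ 1) (trans (ℤP.+-identityʳ (+ n)) (sym (ℤP.*-identityˡ (+ n))))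

    ι : Fin n → ℤ
    ι q = + toℕ q

    reduce : ℤ → Fin n
    reduce a = fromℕ< (n%ℕd<d a n)

    ι-reduce : ∀ a → ι (reduce a) ≡ₙ a
    ι-reduce a = mod $ divides (- (a /ℕ n)) (begin
        ι (reduce a) - a                          ≡⟨ cong (λ r → + r - a) (FP.toℕ-fromℕ< _) ⟩
        + (a %ℕ n) - a                            ≡⟨ cong (λ z → + (a %ℕ n) - z) (a≡a%ℕn+[a/ℕn]*n a n) ⟩
        + (a %ℕ n) - (+ (a %ℕ n) + a /ℕ n * + n)  ≡⟨ identity (+ (a %ℕ n)) (a /ℕ n) (+ n) ⟩
        - (a /ℕ n) * + n                          ∎)
      where
      open ≡-Reasoning
      identity : ∀ r q m → r - (r + q * m) ≡ - q * m
      identity = solve-∀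

    ≡ₙ⇒≡ : ∀ {p r} → p ℕ.< n → r ℕ.< n → + p ≡ₙ + r → p ≡ r
    ≡ₙ⇒≡ {p} {r} p<n r<n e with ∣ p ⊖ r ∣ in eq
    ... | zero = ℤP.+-injective (ℤP.i-j≡0⇒i≡j (+ p) (+ r)
                   (trans (ℤP.m-n≡m⊖n p r) (ℤP.∣i∣≡0⇒i≡0 eq)))
    ... | suc d = contradiction (ℕ∣.∣⇒≤ n∣) (ℕP.<⇒≱ d<n)
      where
      n∣ : n ℕ∣.∣ suc d
      n∣ = subst (n ℕ∣.∣_) (trans (cong ∣_∣ (ℤP.m-n≡m⊖n p r)) eq)
                 (∣⇒∣ᵤ (_≡ₙ_.divides-difference e))
      d<n : suc d ℕ.< n
      d<n = subst (ℕ._< n) eq (ℕP.≤-<-trans (ℤP.∣m⊝n∣≤m⊔n p r) (ℕP.⊔-lub p<n r<n))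

    ι-injective : ∀ {q q'} → ι q ≡ₙ ι q' → q ≡ q'
    ι-injective {q} {q'} e = FP.toℕ-injective (≡ₙ⇒≡ (FP.toℕ<n q) (FP.toℕ<n q') e)

    reduce-cong : ∀ {a b} → a ≡ₙ b → reduce a ≡ reduce b
    reduce-cong {a} {b} e = ι-injective (≡ₙ-trans (ι-reduce a) (≡ₙ-trans e (≡ₙ-sym (ι-reduce b))))

    record Shift (q q' : Fin n) (d : ℤ) : Set where
      constructor shift
      field unshift : ι q' ≡ₙ ι q + d
    open Shift public

    Shift-cong : ∀ {q q' d d'} → d ≡ₙ d' → Shift q q' d → Shift q q' d'
    Shift-cong {q} e (shift s) = shift (≡ₙ-trans s (+-cong-≡ₙ (≡ₙ-refl {ι q}) e))

    Shift-flip : ∀ {q q' d} → Shift q q' d → Shift q' q (- d)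
    Shift-flip {q} {q'} {d} (shift s) =
      shift (≡ₙ-trans (≡ₙ-reflexive (identity (ι q) d)) (+-cong-≡ₙ (≡ₙ-sym s) (≡ₙ-refl { - d})))
      where
      identity : ∀ x d → x ≡ (x + d) + - d
      identity = solve-∀

    Shift-zero⇔≡ : ∀ {q q' d} → d ≡ₙ + 0 → Shift q q' d ⇔ q ≡ q'
    Shift-zero⇔≡ {q} {q'} {d} e = mk⇔
      (λ (shift s) → sym (ι-injective (≡ₙ-trans s (≡ₙ-trans (+-cong-≡ₙ (≡ₙ-refl {ι q}) e) q+0≡q))))
      (λ { refl → shift (≡ₙ-trans (≡ₙ-sym q+0≡q) (+-cong-≡ₙ (≡ₙ-refl {ι q}) (≡ₙ-sym e))) })
      where
      q+0≡q : ι q + + 0 ≡ₙ ι q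
      q+0≡q = ≡ₙ-reflexive (ℤP.+-identityʳ (ι q))

    CycArc⇔Shift : ∀ {q q'} → CycArc n q q' ⇔ Shift q q' (+ 1)
    CycArc⇔Shift {q} {q'} = mk⇔ to from
      where
      ι-suc : + suc (toℕ q) ≡ ι q + + 1
      ι-suc = cong +_ (ℕP.+-comm 1 (toℕ q))
      to : CycArc n q q' → Shift q q' (+ 1)
      to (inj₁ e) = shift (≡ₙ-reflexive (trans (cong +_ (sym e)) ι-suc))
      to (inj₂ (e , e')) = shift (≡ₙ-trans (≡ₙ-reflexive (cong +_ e'))
                             (≡ₙ-trans (≡ₙ-sym n≡ₙ0) (≡ₙ-reflexive (trans (cong +_ (sym e)) ι-suc))))
      from : Shift q q' (+ 1) → CycArc n q q'
      from (shift s) with ℕP.m≤n⇒m<n∨m≡n (FP.toℕ<n q)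
      ... | inj₁ q+1<n = inj₁ (sym (≡ₙ⇒≡ (FP.toℕ<n q') q+1<n (≡ₙ-trans s (≡ₙ-reflexive (sym ι-suc)))))
      ... | inj₂ q+1≡n = inj₂ (q+1≡n , ≡ₙ⇒≡ (FP.toℕ<n q') (ℕ.>-nonZero⁻¹ n)
                           (≡ₙ-trans s (≡ₙ-trans (≡ₙ-reflexive (trans (sym ι-suc) (cong +_ q+1≡n))) n≡ₙ0)))

    CycDir⇔Shift : ∀ b {q q'} → CycDir n b q q' ⇔ Shift q q' (sign b)
    CycDir⇔Shift true = CycArc⇔Shift
    CycDir⇔Shift false = mk⇔
      (λ c → Shift-flip (Equivalence.to CycArc⇔Shift c))
      (λ s → Equivalence.from CycArc⇔Shift (Shift-flip s))

module DigraphAlgebra where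

  open import Data.Nat using (ℕ; zero; suc; _+_; _*_)
  open import Data.Fin as F using (Fin)
  import Data.Fin.Properties as FP
  open import Data.Bool using (Bool; true)
  open import Data.Unit using (tt)
  open import Data.Product using (Σ; _,_; _×_; proj₁; proj₂)
  open import Data.Sum using (_⊎_; inj₁; inj₂)
  open import Function using (_∘_)
  open import Function.Bundles using (_↔_; Inverse; mk↔ₛ′; mk⇔)
  open import Function.Properties.Inverse using (↔-sym)
  open import Relation.Binary.Definitions using (DecidableEquality)
  open import Relation.Nullary using (yes; no)
  open import Relation.Binary.PropositionalEquality

  open Graph
  open Digraph

  record Iso {A B : Set} (R : A → A → Set) (S : B → B → Set) : Set where
    constructor iso
    field
      to       : A → B
      from     : B → A
      to-from  : ∀ y → to (from y) ≡ y
      from-to  : ∀ x → from (to x) ≡ x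
      to-arc   : ∀ x y → R x y → S (to x) (to y)
      from-arc : ∀ x y → S (to x) (to y) → R x y
  open Iso public

  infix 4 _≅ᴰ_ _≅ᴳ_
  _≅ᴰ_ : Digraph → Digraph → Set
  D ≅ᴰ D' = Iso (Arc D) (Arc D')

  _≅ᴳ_ : Graph → Graph → Set
  G ≅ᴳ H = Iso (Adj G) (Adj H)

  module _ {A : Set} {R : A → A → Set} where

    Iso-refl : Iso R R
    Iso-refl = iso (λ x → x) (λ x → x) (λ _ → refl) (λ _ → refl) (λ _ _ a → a) (λ _ _ a → a)

  module _ {A B : Set} {R : A → A → Set} {S : B → B → Set} where

    Iso-sym : Iso R S → Iso S R
    Iso-sym i = iso (from i) (to i) (from-to i) (to-from i)
      (λ u v s → from-arc i _ _ (subst₂ S (sym (to-from i u)) (sym (to-from i v)) s))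
      (λ u v r → subst₂ S (to-from i u) (to-from i v) (to-arc i _ _ r))

  module _ {A B C : Set} {R : A → A → Set} {S : B → B → Set} {Q : C → C → Set} where

    Iso-trans : Iso R S → Iso S Q → Iso R Q
    Iso-trans i j = iso (to j ∘ to i) (from i ∘ from j)
      (λ z → trans (cong (to j) (to-from i _)) (to-from j z))
      (λ x → trans (cong (from i) (from-to j _)) (from-to i x))
      (λ x y r → to-arc j _ _ (to-arc i x y r))
      (λ x y q → from-arc i x y (from-arc j _ _ q))

  ≡⇒≅ᴰ : ∀ {D D'} → D ≡ D' → D ≅ᴰ D'
  ≡⇒≅ᴰ refl = Iso-refl

  ≡⇒≅ᴳ : ∀ {G H} → G ≡ H → G ≅ᴳ H
  ≡⇒≅ᴳ refl = Iso-refl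

  ≅ᴳ⇒≅ : ∀ {G H} → G ≅ᴳ H → G ≅ H
  ≅ᴳ⇒≅ i = mk↔ₛ′ (to i) (from i) (to-from i) (from-to i) , λ x y → mk⇔ (to-arc i x y) (from-arc i x y)

  und-cong : ∀ {D D'} → D ≅ᴰ D' → und D ≅ᴳ und D'
  und-cong i = iso (to i) (from i) (to-from i) (from-to i)
    (λ x y → λ { (inj₁ a) → inj₁ (to-arc i x y a) ; (inj₂ a) → inj₂ (to-arc i y x a) })
    (λ x y → λ { (inj₁ a) → inj₁ (from-arc i x y a) ; (inj₂ a) → inj₂ (from-arc i y x a) })

  infixr 5 _⊕_

  data SumArc (D E : Digraph) : V D ⊎ V E → V D ⊎ V E → Set where
    left  : ∀ {x y} → Arc D x y → SumArc D E (inj₁ x) (inj₁ y)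
    right : ∀ {x y} → Arc E x y → SumArc D E (inj₂ x) (inj₂ y)

  _⊕_ : Digraph → Digraph → Digraph
  D ⊕ E = record { V = V D ⊎ V E ; Arc = SumArc D E }

  ⊕-cong : ∀ {D D' E E'} → D ≅ᴰ D' → E ≅ᴰ E' → D ⊕ E ≅ᴰ D' ⊕ E'
  ⊕-cong {D} {D'} {E} {E'} i j = iso f g fg gf fw bw
    where
    f : V D ⊎ V E → V D' ⊎ V E'
    f (inj₁ x) = inj₁ (to i x)
    f (inj₂ x) = inj₂ (to j x)
    g : V D' ⊎ V E' → V D ⊎ V E
    g (inj₁ x) = inj₁ (from i x)
    g (inj₂ x) = inj₂ (from j x)
    fg : ∀ y → f (g y) ≡ y
    fg (inj₁ x) = cong inj₁ (to-from i x)
    fg (inj₂ x) = cong inj₂ (to-from j x)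
    gf : ∀ y → g (f y) ≡ y
    gf (inj₁ x) = cong inj₁ (from-to i x)
    gf (inj₂ x) = cong inj₂ (from-to j x)
    fw : ∀ x y → SumArc D E x y → SumArc D' E' (f x) (f y)
    fw _ _ (left a)  = left (to-arc i _ _ a)
    fw _ _ (right a) = right (to-arc j _ _ a)
    bw : ∀ x y → SumArc D' E' (f x) (f y) → SumArc D E x y
    bw (inj₁ x) (inj₁ y) (left a)  = left (from-arc i x y a)
    bw (inj₂ x) (inj₂ y) (right a) = right (from-arc j x y a)

  ⊕-assoc : ∀ D E K → (D ⊕ E) ⊕ K ≅ᴰ D ⊕ (E ⊕ K)
  ⊕-assoc D E K = iso f g fg gf fw bw
    where
    f : (V D ⊎ V E) ⊎ V K → V D ⊎ (V E ⊎ V K)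
    f (inj₁ (inj₁ x)) = inj₁ x
    f (inj₁ (inj₂ x)) = inj₂ (inj₁ x)
    f (inj₂ x)        = inj₂ (inj₂ x)
    g : V D ⊎ (V E ⊎ V K) → (V D ⊎ V E) ⊎ V K
    g (inj₁ x)        = inj₁ (inj₁ x)
    g (inj₂ (inj₁ x)) = inj₁ (inj₂ x)
    g (inj₂ (inj₂ x)) = inj₂ x
    fg : ∀ y → f (g y) ≡ y
    fg (inj₁ x)        = refl
    fg (inj₂ (inj₁ x)) = refl
    fg (inj₂ (inj₂ x)) = refl
    gf : ∀ y → g (f y) ≡ y
    gf (inj₁ (inj₁ x)) = refl
    gf (inj₁ (inj₂ x)) = refl
    gf (inj₂ x)        = refl
    fw : ∀ x y → Arc ((D ⊕ E) ⊕ K) x y → Arc (D ⊕ (E ⊕ K)) (f x) (f y)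
    fw _ _ (left (left a))  = left a
    fw _ _ (left (right a)) = right (left a)
    fw _ _ (right a)        = right (right a)
    bw : ∀ x y → Arc (D ⊕ (E ⊕ K)) (f x) (f y) → Arc ((D ⊕ E) ⊕ K) x y
    bw (inj₁ (inj₁ x)) (inj₁ (inj₁ y)) (left a)          = left (left a)
    bw (inj₁ (inj₂ x)) (inj₁ (inj₂ y)) (right (left a))  = left (right a)
    bw (inj₂ x)        (inj₂ y)        (right (right a)) = right a
    bw (inj₁ (inj₂ x)) (inj₂ y)        (right ())
    bw (inj₂ x)        (inj₁ (inj₂ y)) (right ())
    bw (inj₂ x)        (inj₁ (inj₁ y)) ()

  data UnionArc {I : Set} (F : I → Digraph) : Σ I (V ∘ F) → Σ I (V ∘ F) → Set where
    inside : ∀ i {x y} → Arc (F i) x y → UnionArc F (i , x) (i , y)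

  ⋃ : (I : Set) → (I → Digraph) → Digraph
  ⋃ I F = record { V = Σ I (V ∘ F) ; Arc = UnionArc F }

  Copies : ℕ → Digraph → Digraph
  Copies c D = ⋃ (Fin c) (λ _ → D)

  ⋃-cong : ∀ {I} {F G : I → Digraph} → (∀ i → F i ≅ᴰ G i) → ⋃ I F ≅ᴰ ⋃ I G
  ⋃-cong {I} {F} {G} i = iso f g fg gf fw bw
    where
    f : V (⋃ I F) → V (⋃ I G)
    f (k , x) = k , to (i k) x
    g : V (⋃ I G) → V (⋃ I F)
    g (k , x) = k , from (i k) x
    fg : ∀ y → f (g y) ≡ y
    fg (k , x) = cong (k ,_) (to-from (i k) x)
    gf : ∀ y → g (f y) ≡ y
    gf (k , x) = cong (k ,_) (from-to (i k) x)
    fw : ∀ x y → UnionArc F x y → UnionArc G (f x) (f y)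
    fw _ _ (inside k a) = inside k (to-arc (i k) _ _ a)
    bw : ∀ x y → UnionArc G (f x) (f y) → UnionArc F x y
    bw (k , x) (.k , y) (inside .k a) = inside k (from-arc (i k) x y a)

  und-⋃ : ∀ I (F : I → Digraph) → und (⋃ I F) ≅ᴳ DisjUnion I (und ∘ F)
  und-⋃ I F = iso (λ x → x) (λ x → x) (λ _ → refl) (λ _ → refl) fw bw
    where
    fw : ∀ x y → Adj (und (⋃ I F)) x y → Adj (DisjUnion I (und ∘ F)) x y
    fw _ _ (inj₁ (inside k a)) = refl , inj₁ a
    fw _ _ (inj₂ (inside k a)) = refl , inj₂ a
    bw : ∀ x y → Adj (DisjUnion I (und ∘ F)) x y → Adj (und (⋃ I F)) x y
    bw (k , x) (.k , y) (refl , inj₁ a) = inj₁ (inside k a)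
    bw (k , x) (.k , y) (refl , inj₂ a) = inj₂ (inside k a)

  constant-arc : ∀ {I D} {k k' : I} {x y} → UnionArc (λ _ → D) (k , x) (k' , y) → k ≡ k' × Arc D x y
  constant-arc (inside _ a) = refl , a

  ⋃-reindex : ∀ {I J} (e : I ↔ J) D → ⋃ I (λ _ → D) ≅ᴰ ⋃ J (λ _ → D)
  ⋃-reindex {I} {J} e D = iso f g fg gf fw bw
    where
    open Inverse e using () renaming (to to e⁺; from to e⁻)
    f : I × V D → J × V D
    f (k , x) = e⁺ k , x
    g : J × V D → I × V D
    g (k , x) = e⁻ k , x
    fg : ∀ y → f (g y) ≡ y
    fg (k , x) = cong (_, x) (Inverse.strictlyInverseˡ e k)
    gf : ∀ y → g (f y) ≡ y
    gf (k , x) = cong (_, x) (Inverse.strictlyInverseʳ e k)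
    fw : ∀ x y → Arc (⋃ I (λ _ → D)) x y → Arc (⋃ J (λ _ → D)) (f x) (f y)
    fw _ _ (inside k a) = inside (e⁺ k) a
    bw : ∀ x y → Arc (⋃ J (λ _ → D)) (f x) (f y) → Arc (⋃ I (λ _ → D)) x y
    bw (k , x) (k' , y) arc with constant-arc arc
    ... | e⁺k≡e⁺k' , a = subst (λ j → UnionArc (λ _ → D) (k , x) (j , y)) k≡k' (inside k a)
      where
      k≡k' : k ≡ k'
      k≡k' = trans (sym (Inverse.strictlyInverseʳ e k))
               (trans (cong e⁻ e⁺k≡e⁺k') (Inverse.strictlyInverseʳ e k'))

  ⋃-⊎ : ∀ {A B} (F : A ⊎ B → Digraph) → ⋃ (A ⊎ B) F ≅ᴰ ⋃ A (F ∘ inj₁) ⊕ ⋃ B (F ∘ inj₂)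
  ⋃-⊎ {A} {B} F = iso f g fg gf fw bw
    where
    f : V (⋃ (A ⊎ B) F) → V (⋃ A (F ∘ inj₁) ⊕ ⋃ B (F ∘ inj₂))
    f (inj₁ a , x) = inj₁ (a , x)
    f (inj₂ b , x) = inj₂ (b , x)
    g : V (⋃ A (F ∘ inj₁) ⊕ ⋃ B (F ∘ inj₂)) → V (⋃ (A ⊎ B) F)
    g (inj₁ (a , x)) = inj₁ a , x
    g (inj₂ (b , x)) = inj₂ b , x
    fg : ∀ y → f (g y) ≡ y
    fg (inj₁ _) = refl
    fg (inj₂ _) = refl
    gf : ∀ y → g (f y) ≡ y
    gf (inj₁ _ , _) = refl
    gf (inj₂ _ , _) = refl
    fw : ∀ x y → Arc (⋃ (A ⊎ B) F) x y → Arc (⋃ A (F ∘ inj₁) ⊕ ⋃ B (F ∘ inj₂)) (f x) (f y)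
    fw _ _ (inside (inj₁ a) arc) = left (inside a arc)
    fw _ _ (inside (inj₂ b) arc) = right (inside b arc)
    bw : ∀ x y → Arc (⋃ A (F ∘ inj₁) ⊕ ⋃ B (F ∘ inj₂)) (f x) (f y) → Arc (⋃ (A ⊎ B) F) x y
    bw (inj₁ a , x) (inj₁ .a , y) (left (inside .a arc))  = inside (inj₁ a) arc
    bw (inj₂ b , x) (inj₂ .b , y) (right (inside .b arc)) = inside (inj₂ b) arc

  ⋃-Σ : ∀ {A} {B : A → Set} (F : (a : A) → B a → Digraph) →
        ⋃ A (λ a → ⋃ (B a) (F a)) ≅ᴰ ⋃ (Σ A B) (λ p → F (proj₁ p) (proj₂ p))
  ⋃-Σ {A} {B} F = iso f g (λ _ → refl) (λ _ → refl) fw bw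
    where
    nested = ⋃ A (λ a → ⋃ (B a) (F a))
    flat = ⋃ (Σ A B) (λ p → F (proj₁ p) (proj₂ p))
    f : V nested → V flat
    f (a , b , x) = (a , b) , x
    g : V flat → V nested
    g ((a , b) , x) = a , b , x
    fw : ∀ x y → Arc nested x y → Arc flat (f x) (f y)
    fw _ _ (inside a (inside b arc)) = inside (a , b) arc
    bw : ∀ x y → Arc flat (f x) (f y) → Arc nested x y
    bw (a , b , x) (.a , .b , y) (inside _ arc) = inside a (inside b arc)

  Copies-+ : ∀ c c' D → Copies (c + c') D ≅ᴰ Copies c D ⊕ Copies c' D
  Copies-+ c c' D = Iso-trans (⋃-reindex FP.+↔⊎ D) (⋃-⊎ (λ _ → D))

  Copies-* : ∀ c c' D → Copies c (Copies c' D) ≅ᴰ Copies (c * c') D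
  Copies-* c c' D = Iso-trans (⋃-Σ (λ _ _ → D)) (⋃-reindex (↔-sym FP.*↔×) D)

  Copies-zero-⊕ : ∀ D K → Copies 0 D ⊕ K ≅ᴰ K
  Copies-zero-⊕ D K = iso f inj₂ (λ _ → refl) gf fw bw
    where
    f : V (Copies 0 D ⊕ K) → V K
    f (inj₂ x) = x
    gf : ∀ y → inj₂ (f y) ≡ y
    gf (inj₂ x) = refl
    fw : ∀ x y → Arc (Copies 0 D ⊕ K) x y → Arc K (f x) (f y)
    fw _ _ (right a) = a
    bw : ∀ x y → Arc K (f x) (f y) → Arc (Copies 0 D ⊕ K) x y
    bw (inj₂ x) (inj₂ y) a = right a

  ⋃-Fin-one : ∀ (B : Fin 1 → Set) (F : Σ (Fin 1) B → Digraph) →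
              ⋃ (Σ (Fin 1) B) F ≅ᴰ ⋃ (B F.zero) (λ b → F (F.zero , b))
  ⋃-Fin-one B F = iso f g (λ _ → refl) gf fw bw
    where
    f : V (⋃ (Σ (Fin 1) B) F) → V (⋃ (B F.zero) (λ b → F (F.zero , b)))
    f ((F.zero , b) , x) = b , x
    g : V (⋃ (B F.zero) (λ b → F (F.zero , b))) → V (⋃ (Σ (Fin 1) B) F)
    g (b , x) = (F.zero , b) , x
    gf : ∀ y → g (f y) ≡ y
    gf ((F.zero , b) , x) = refl
    fw : ∀ x y → Arc (⋃ (Σ (Fin 1) B) F) x y → Arc (⋃ (B F.zero) (λ b → F (F.zero , b))) (f x) (f y)
    fw _ _ (inside (F.zero , b) a) = inside b a
    bw : ∀ x y → Arc (⋃ (B F.zero) (λ b → F (F.zero , b))) (f x) (f y) → Arc (⋃ (Σ (Fin 1) B) F) x y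
    bw ((F.zero , b) , x) ((F.zero , .b) , y) (inside .b a) = inside (F.zero , b) a

  ⋃-Fin-suc : ∀ j (B : Fin (suc j) → Set) (F : Σ (Fin (suc j)) B → Digraph) →
              ⋃ (Σ (Fin (suc j)) B) F ≅ᴰ
              ⋃ (B F.zero) (λ b → F (F.zero , b)) ⊕
              ⋃ (Σ (Fin j) (B ∘ F.suc)) (λ p → F (F.suc (proj₁ p) , proj₂ p))
  ⋃-Fin-suc j B F = iso f g fg gf fw bw
    where
    G = ⋃ (B F.zero) (λ b → F (F.zero , b)) ⊕
        ⋃ (Σ (Fin j) (B ∘ F.suc)) (λ p → F (F.suc (proj₁ p) , proj₂ p))
    f : V (⋃ (Σ (Fin (suc j)) B) F) → V G
    f ((F.zero , b) , x) = inj₁ (b , x)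
    f ((F.suc i , b) , x) = inj₂ ((i , b) , x)
    g : V G → V (⋃ (Σ (Fin (suc j)) B) F)
    g (inj₁ (b , x)) = (F.zero , b) , x
    g (inj₂ ((i , b) , x)) = (F.suc i , b) , x
    fg : ∀ y → f (g y) ≡ y
    fg (inj₁ _) = refl
    fg (inj₂ _) = refl
    gf : ∀ y → g (f y) ≡ y
    gf ((F.zero , b) , x) = refl
    gf ((F.suc i , b) , x) = refl
    fw : ∀ x y → Arc (⋃ (Σ (Fin (suc j)) B) F) x y → Arc G (f x) (f y)
    fw _ _ (inside (F.zero , b) a) = left (inside b a)
    fw _ _ (inside (F.suc i , b) a) = right (inside (i , b) a)
    bw : ∀ x y → Arc G (f x) (f y) → Arc (⋃ (Σ (Fin (suc j)) B) F) x y
    bw ((F.zero , b) , x) ((F.zero , .b) , y) (left (inside .b a)) = inside (F.zero , b) a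
    bw ((F.suc i , b) , x) ((F.suc .i , .b) , y) (right (inside .(i , b) a)) = inside (F.suc i , b) a

  DisjUnion-cong : ∀ {I} {G H : I → Graph} → (∀ i → G i ≅ᴳ H i) → DisjUnion I G ≅ᴳ DisjUnion I H
  DisjUnion-cong {I} {G} {H} i = iso f g fg gf fw bw
    where
    f : V (DisjUnion I G) → V (DisjUnion I H)
    f (k , x) = k , to (i k) x
    g : V (DisjUnion I H) → V (DisjUnion I G)
    g (k , x) = k , from (i k) x
    fg : ∀ y → f (g y) ≡ y
    fg (k , x) = cong (k ,_) (to-from (i k) x)
    gf : ∀ y → g (f y) ≡ y
    gf (k , x) = cong (k ,_) (from-to (i k) x)
    fw : ∀ x y → Adj (DisjUnion I G) x y → Adj (DisjUnion I H) (f x) (f y)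
    fw (k , x) (.k , y) (refl , a) = refl , to-arc (i k) x y a
    bw : ∀ x y → Adj (DisjUnion I H) (f x) (f y) → Adj (DisjUnion I G) x y
    bw (k , x) (.k , y) (refl , a) = refl , from-arc (i k) x y a

  module Products (n : ℕ) where

    -- Labels depend on the endpoints of an arc only, so that they can be pulled back along isomorphisms.
    ELabel : Digraph → Set
    ELabel D = V D → V D → Bool

    infixl 6 _⊗_
    _⊗_ : (D : Digraph) → ELabel D → Digraph
    D ⊗ ℓ = prod n D (λ x y _ → ℓ x y)

    pullback : ∀ {D D'} → D ≅ᴰ D' → ELabel D' → ELabel D
    pullback i ℓ x y = ℓ (to i x) (to i y)

    ⊗-cong : ∀ {D D'} (i : D ≅ᴰ D') (ℓ : ELabel D') → D ⊗ pullback i ℓ ≅ᴰ D' ⊗ ℓ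
    ⊗-cong {D} {D'} i ℓ = iso f g fg gf fw bw
      where
      f : V D × Fin n → V D' × Fin n
      f (x , q) = to i x , q
      g : V D' × Fin n → V D × Fin n
      g (x , q) = from i x , q
      fg : ∀ y → f (g y) ≡ y
      fg (x , q) = cong (_, q) (to-from i x)
      gf : ∀ y → g (f y) ≡ y
      gf (x , q) = cong (_, q) (from-to i x)
      fw : ∀ x y → Arc (D ⊗ pullback i ℓ) x y → Arc (D' ⊗ ℓ) (f x) (f y)
      fw (x , _) (y , _) (a , c) = to-arc i x y a , c
      bw : ∀ x y → Arc (D' ⊗ ℓ) (f x) (f y) → Arc (D ⊗ pullback i ℓ) x y
      bw (x , _) (y , _) (a , c) = from-arc i x y a , c

    _⊕ˡ_ : ∀ {D E} → ELabel D → ELabel E → ELabel (D ⊕ E)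
    (ℓ ⊕ˡ ℓ') (inj₁ x) (inj₁ y) = ℓ x y
    (ℓ ⊕ˡ ℓ') (inj₂ x) (inj₂ y) = ℓ' x y
    (ℓ ⊕ˡ ℓ') _        _        = true

    ⊗-⊕ : ∀ {D E} (ℓ : ELabel D) (ℓ' : ELabel E) →
          (D ⊕ E) ⊗ (_⊕ˡ_ {D} {E} ℓ ℓ') ≅ᴰ (D ⊗ ℓ) ⊕ (E ⊗ ℓ')
    ⊗-⊕ {D} {E} ℓ ℓ' = iso f g fg gf fw bw
      where
      f : (V D ⊎ V E) × Fin n → (V D × Fin n) ⊎ (V E × Fin n)
      f (inj₁ x , q) = inj₁ (x , q)
      f (inj₂ x , q) = inj₂ (x , q)
      g : (V D × Fin n) ⊎ (V E × Fin n) → (V D ⊎ V E) × Fin n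
      g (inj₁ (x , q)) = inj₁ x , q
      g (inj₂ (x , q)) = inj₂ x , q
      fg : ∀ y → f (g y) ≡ y
      fg (inj₁ _) = refl
      fg (inj₂ _) = refl
      gf : ∀ y → g (f y) ≡ y
      gf (inj₁ _ , _) = refl
      gf (inj₂ _ , _) = refl
      fw : ∀ x y → Arc ((D ⊕ E) ⊗ (_⊕ˡ_ {D} {E} ℓ ℓ')) x y → Arc ((D ⊗ ℓ) ⊕ (E ⊗ ℓ')) (f x) (f y)
      fw _ _ (left a , c)  = left (a , c)
      fw _ _ (right a , c) = right (a , c)
      bw : ∀ x y → Arc ((D ⊗ ℓ) ⊕ (E ⊗ ℓ')) (f x) (f y) → Arc ((D ⊕ E) ⊗ (_⊕ˡ_ {D} {E} ℓ ℓ')) x y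
      bw (inj₁ _ , _) (inj₁ _ , _) (left (a , c))  = left a , c
      bw (inj₂ _ , _) (inj₂ _ , _) (right (a , c)) = right a , c

    module _ {I : Set} (_≟_ : DecidableEquality I) {F : I → Digraph} where

      ⋃ˡ : (∀ i → ELabel (F i)) → ELabel (⋃ I F)
      ⋃ˡ ℓ (i , x) (j , y) with i ≟ j
      ... | yes refl = ℓ i x y
      ... | no _     = true

      ⋃ˡ-inside : ∀ ℓ i x y → ⋃ˡ ℓ (i , x) (i , y) ≡ ℓ i x y
      ⋃ˡ-inside ℓ i x y rewrite ≡-≟-identity _≟_ {i} refl = refl

      ⊗-⋃ : ∀ ℓ → ⋃ I F ⊗ ⋃ˡ ℓ ≅ᴰ ⋃ I (λ i → F i ⊗ ℓ i)
      ⊗-⋃ ℓ = iso f g (λ _ → refl) (λ _ → refl) fw bw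
        where
        f : V (⋃ I F ⊗ ⋃ˡ ℓ) → V (⋃ I (λ i → F i ⊗ ℓ i))
        f ((i , x) , q) = i , x , q
        g : V (⋃ I (λ i → F i ⊗ ℓ i)) → V (⋃ I F ⊗ ⋃ˡ ℓ)
        g (i , x , q) = (i , x) , q
        fw : ∀ x y → Arc (⋃ I F ⊗ ⋃ˡ ℓ) x y → Arc (⋃ I (λ i → F i ⊗ ℓ i)) (f x) (f y)
        fw ((i , x) , q) ((.i , y) , q') (inside .i a , c) =
          inside i (a , subst (λ b → CycDir n b q q') (⋃ˡ-inside ℓ i x y) c)
        bw : ∀ x y → Arc (⋃ I (λ i → F i ⊗ ℓ i)) (f x) (f y) → Arc (⋃ I F ⊗ ⋃ˡ ℓ) x y
        bw ((i , x) , q) ((.i , y) , q') (inside .i (a , c)) =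
          inside i a , subst (λ b → CycDir n b q q') (sym (⋃ˡ-inside ℓ i x y)) c

    Reaches : ℕ → Digraph → Digraph → Set
    Reaches zero    D K = D ≅ᴰ K
    Reaches (suc r) D K = Σ (ELabel D) λ ℓ → Reaches r (D ⊗ ℓ) K

    reaches-source : ∀ r {D D' K} → D ≅ᴰ D' → Reaches r D' K → Reaches r D K
    reaches-source zero    i j       = Iso-trans i j
    reaches-source (suc r) i (ℓ , ρ) = pullback i ℓ , reaches-source r (⊗-cong i ℓ) ρ

    reaches-target : ∀ r {D K K'} → Reaches r D K → K ≅ᴰ K' → Reaches r D K'
    reaches-target zero    ρ       i = Iso-trans ρ i
    reaches-target (suc r) (ℓ , ρ) i = ℓ , reaches-target r ρ i

    reaches-trans : ∀ r₁ {r₂ D H K} → Reaches r₁ D H → Reaches r₂ H K → Reaches (r₁ + r₂) D K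
    reaches-trans zero     {r₂} i ρ' = reaches-source r₂ i ρ'
    reaches-trans (suc r₁) (ℓ , ρ) ρ' = ℓ , reaches-trans r₁ ρ ρ'

    reaches-⊕ : ∀ r {D D' K K'} → Reaches r D K → Reaches r D' K' → Reaches r (D ⊕ D') (K ⊕ K')
    reaches-⊕ zero    i j = ⊕-cong i j
    reaches-⊕ (suc r) {D} {D'} (ℓ , ρ) (ℓ' , ρ') =
      _⊕ˡ_ {D} {D'} ℓ ℓ' , reaches-source r (⊗-⊕ ℓ ℓ') (reaches-⊕ r ρ ρ')

    reaches-⋃ : ∀ r {I} → DecidableEquality I → {F G : I → Digraph} →
                (∀ i → Reaches r (F i) (G i)) → Reaches r (⋃ I F) (⋃ I G)
    reaches-⋃ zero    _   ρ = ⋃-cong ρ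
    reaches-⋃ (suc r) _≟_ ρ =
      ⋃ˡ _≟_ (proj₁ ∘ ρ) , reaches-source r (⊗-⋃ _≟_ (proj₁ ∘ ρ)) (reaches-⋃ r _≟_ (proj₂ ∘ ρ))

    reaches-Copies : ∀ r c {D K} → Reaches r D K → Reaches r (Copies c D) (Copies c K)
    reaches-Copies r c ρ = reaches-⋃ r FP._≟_ (λ _ → ρ)

    stage-zero : ∀ r D hs → stage n r D hs 0 ≡ D
    stage-zero zero    D hs = refl
    stage-zero (suc r) D hs = refl

    realise : ∀ r {D K} → Reaches r D K → Σ (Labelings n r D) λ hs → stage n r D hs r ≅ᴰ K
    realise zero    i       = tt , i
    realise (suc r) (ℓ , ρ) = let hs , i = realise r ρ in ((λ x y _ → ℓ x y) , hs) , i

    realise-via : ∀ r₁ {r₂ D H K} → Reaches r₁ D H → Reaches r₂ H K →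
                  Σ (Labelings n (r₁ + r₂) D) λ hs →
                    (stage n (r₁ + r₂) D hs r₁ ≅ᴰ H) × (stage n (r₁ + r₂) D hs (r₁ + r₂) ≅ᴰ K)
    realise-via zero {r₂} {D} {H} i ρ' =
      let hs , j = realise r₂ (reaches-source r₂ i ρ') in
      hs , subst (_≅ᴰ H) (sym (stage-zero r₂ D hs)) i , j
    realise-via (suc r₁) (ℓ , ρ) ρ' =
      let hs , i , j = realise-via r₁ ρ ρ' in ((λ x y _ → ℓ x y) , hs) , i , j

module OddCycles where

  open import Data.Nat using (ℕ; zero; suc; _+_; _*_; _≤_; _<_; z≤n; s≤s)
  import Data.Nat.Properties as ℕP
  open import Data.Nat.Induction using (<-rec)
  open import Data.Nat.Tactic.RingSolver using (solve-∀)
  open import Data.Nat.DivMod using (_%_)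
  import Data.Nat.DivMod as DM
  open import Data.Fin as F using (Fin; toℕ)
  import Data.Fin.Properties as FP
  open import Data.Bool using (Bool; true; false; not; _xor_; _∧_; if_then_else_)
  open import Data.Bool.Properties using (not-involutive)
  open import Data.Product using (Σ; ∃; _,_; _×_)
  open import Data.Sum using (inj₁; inj₂)
  open import Data.Empty using (⊥-elim)
  open import Relation.Nullary using (¬_; Dec; yes; no)
  open import Relation.Nullary.Decidable using (_×-dec_)
  open import Relation.Binary.Definitions using (tri<; tri≈; tri>)
  open import Relation.Binary.PropositionalEquality

  parity : ℕ → Bool
  parity zero    = false
  parity (suc n) = not (parity n)

  parity-+ : ∀ a b → parity (a + b) ≡ parity a xor parity b
  parity-+ zero    b = refl
  parity-+ (suc a) b = trans (cong not (parity-+ a b)) (not-xor (parity a) (parity b))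
    where
    not-xor : ∀ x y → not (x xor y) ≡ not x xor y
    not-xor true  y = not-involutive y
    not-xor false y = refl

  parity-* : ∀ a b → parity (a * b) ≡ parity a ∧ parity b
  parity-* zero    b = refl
  parity-* (suc a) b = trans (parity-+ b (a * b))
                             (trans (cong (parity b xor_) (parity-* a b)) (xor-∧ (parity b) (parity a)))
    where
    xor-∧ : ∀ x y → x xor (y ∧ x) ≡ not y ∧ x
    xor-∧ true  true  = refl
    xor-∧ true  false = refl
    xor-∧ false true  = refl
    xor-∧ false false = refl

  %2-parity : ∀ a → a % 2 ≡ (if parity a then 1 else 0)
  %2-parity zero          = refl
  %2-parity (suc zero)    = refl
  %2-parity (suc (suc a)) = begin
      (2 + a) % 2                           ≡⟨ cong (_% 2) (ℕP.+-comm 2 a) ⟩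
      (a + 2) % 2                           ≡⟨ DM.[m+n]%n≡m%n a 2 ⟩
      a % 2                                 ≡⟨ %2-parity a ⟩
      (if parity a then 1 else 0)           ≡⟨ cong (λ b → if b then 1 else 0) (not-involutive (parity a)) ⟨
      (if parity (suc (suc a)) then 1 else 0) ∎
    where open ≡-Reasoning

  %2≡1⇒parity : ∀ a → a % 2 ≡ 1 → parity a ≡ true
  %2≡1⇒parity a a%2≡1 with parity a | %2-parity a
  ... | true  | _ = refl
  ... | false | e with () ← trans (sym a%2≡1) e

  parity⇒%2≡1 : ∀ a → parity a ≡ true → a % 2 ≡ 1
  parity⇒%2≡1 a p = trans (%2-parity a) (cong (λ b → if b then 1 else 0) p)

  module _ {k : ℕ} {A : Fin k → Fin k → Set} where

    length : ∀ {x y} → Walk A x y → ℕ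
    length (here x)   = 0
    length (step a w) = suc (length w)

    vertexAt : ∀ {x y} → Walk A x y → ℕ → Fin k
    vertexAt (here x)           _       = x
    vertexAt (step {x} a w)     zero    = x
    vertexAt (step a w)         (suc t) = vertexAt w t

    vertexAt-zero : ∀ {x y} (w : Walk A x y) → vertexAt w 0 ≡ x
    vertexAt-zero (here x)   = refl
    vertexAt-zero (step a w) = refl

    vertexAt-length : ∀ {x y} (w : Walk A x y) → vertexAt w (length w) ≡ y
    vertexAt-length (here x)   = refl
    vertexAt-length (step a w) = vertexAt-length w

    vertexAt-arc : ∀ {x y} (w : Walk A x y) t → t < length w → A (vertexAt w t) (vertexAt w (suc t))
    vertexAt-arc (step {x} a w) zero    _       = subst (A x) (sym (vertexAt-zero w)) a
    vertexAt-arc (step a w)     (suc t) (s≤s p) = vertexAt-arc w t p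

    infixr 5 _++ʷ_
    _++ʷ_ : ∀ {x y z} → Walk A x y → Walk A y z → Walk A x z
    here x   ++ʷ v = v
    step a u ++ʷ v = step a (u ++ʷ v)

    length-++ : ∀ {x y z} (u : Walk A x y) (v : Walk A y z) → length (u ++ʷ v) ≡ length u + length v
    length-++ (here x)   v = refl
    length-++ (step a u) v = cong suc (length-++ u v)

    cast-start : ∀ {x x' y} → x ≡ x' → Walk A x y → Walk A x' y
    cast-start refl w = w

    cast-end : ∀ {x y y'} → y ≡ y' → Walk A x y → Walk A x y'
    cast-end refl w = w

    length-cast-start : ∀ {x x' y} (e : x ≡ x') (w : Walk A x y) → length (cast-start e w) ≡ length w
    length-cast-start refl w = refl

    length-cast-end : ∀ {x y y'} (e : y ≡ y') (w : Walk A x y) → length (cast-end e w) ≡ length w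
    length-cast-end refl w = refl

    record Cut {x z} (w : Walk A x z) (t : ℕ) : Set where
      field
        prefix          : Walk A x (vertexAt w t)
        suffix          : Walk A (vertexAt w t) z
        length-prefix   : length prefix ≡ t
        length-cut      : length prefix + length suffix ≡ length w
        prefix-vertexAt : ∀ s → s ≤ t → vertexAt prefix s ≡ vertexAt w s

    cut : ∀ {x z} (w : Walk A x z) t → t ≤ length w → Cut w t
    cut (here x)       zero    _ = record
      { prefix = here x ; suffix = here x ; length-prefix = refl ; length-cut = refl
      ; prefix-vertexAt = λ { zero _ → refl } }
    cut (step {x} a w) zero    _ = record
      { prefix = here x ; suffix = step a w ; length-prefix = refl ; length-cut = refl
      ; prefix-vertexAt = λ { zero _ → refl } }
    cut (step a w)     (suc t) (s≤s t≤) = record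
      { prefix = step a prefix ; suffix = suffix ; length-prefix = cong suc length-prefix
      ; length-cut = cong suc length-cut
      ; prefix-vertexAt = λ { zero _ → refl ; (suc s) (s≤s s≤t) → prefix-vertexAt s s≤t } }
      where open Cut (cut w t t≤)

    module _ (irreflexive : ∀ x → ¬ A x x) where

      Repetition : ∀ {x} → Walk A x x → Set
      Repetition w = ∃ λ (i : Fin (length w)) → ∃ λ (j : Fin (length w)) →
                     i F.< j × vertexAt w (toℕ i) ≡ vertexAt w (toℕ j)

      repetition? : ∀ {x} (w : Walk A x x) → Dec (Repetition w)
      repetition? w = FP.any? λ i → FP.any? λ j →
                      (i F.<? j) ×-dec (vertexAt w (toℕ i) FP.≟ vertexAt w (toℕ j))

      simple-closed-walk⇒cycle : ∀ {x} (w : Walk A x x) → ¬ Repetition w → parity (length w) ≡ true → HasCycle A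
      simple-closed-walk⇒cycle (here _)                   _ ()
      simple-closed-walk⇒cycle (step a (here _))          _ _  = ⊥-elim (irreflexive _ a)
      simple-closed-walk⇒cycle (step _ (step _ (here _))) _ ()
      simple-closed-walk⇒cycle {x} w@(step _ (step _ (step _ w'))) simple _ = length w' , c , c-injective , c-arc
        where
        c : Fin (length w) → Fin k
        c i = vertexAt w (toℕ i)
        c-injective : ∀ {i j} → c i ≡ c j → i ≡ j
        c-injective {i} {j} e with FP.<-cmp i j
        ... | tri< i<j _ _ = ⊥-elim (simple (i , j , i<j , e))
        ... | tri≈ _ i≡j _ = i≡j
        ... | tri> _ _ j<i = ⊥-elim (simple (j , i , j<i , sym e))
        c-arc : ∀ i j → CycArc (length w) i j → A (c i) (c j)
        c-arc i j (inj₁ i+1≡j) =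
          subst (λ t → A (c i) (vertexAt w t)) i+1≡j (vertexAt-arc w (toℕ i) (FP.toℕ<n i))
        c-arc i j (inj₂ (i+1≡L , j≡0)) =
          subst (A (c i)) (trans (trans (cong (vertexAt w) i+1≡L) (vertexAt-length w)) (cong (vertexAt w) (sym j≡0)))
                (vertexAt-arc w (toℕ i) (FP.toℕ<n i))

      record Split {x} (w : Walk A x x) : Set where
        field
          {base}      : Fin k
          loop        : Walk A base base
          rest        : Walk A x x
          length-split : length loop + length rest ≡ length w
          loop-nonempty : 1 ≤ length loop
          rest-nonempty : 1 ≤ length rest

      split-at-repetition : ∀ {x} (w : Walk A x x) → Repetition w → Split w
      split-at-repetition {x} w (i , j , i<j , same) = record
        { loop = loop
        ; rest = rest
        ; length-split = begin
            length loop + length rest  ≡⟨ cong₂ _+_ (length-cast-start meet (suffix inner)) length-rest ⟩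
            b + (a + c)                ≡⟨ rearrange a b c ⟩
            (a + b) + c                ≡⟨ cong (_+ c) a+b≡j ⟩
            toℕ j + c                  ≡⟨ j+c≡length ⟩
            length w                   ∎
        ; loop-nonempty = subst (1 ≤_) (sym (length-cast-start meet (suffix inner)))
                            (positive-summand a+b≡j (subst (_< toℕ j) (sym (length-prefix inner)) i<j))
        ; rest-nonempty = subst (1 ≤_) (sym length-rest)
                            (ℕP.≤-trans (positive-summand j+c≡length (FP.toℕ<n j)) (ℕP.m≤n+m c a)) }
        where
        open Cut
        open ≡-Reasoning
        outer = cut w (toℕ j) (ℕP.<⇒≤ (FP.toℕ<n j))
        inner = cut (prefix outer) (toℕ i) (subst (toℕ i ≤_) (sym (length-prefix outer)) (ℕP.<⇒≤ i<j))
        meet : vertexAt (prefix outer) (toℕ i) ≡ vertexAt w (toℕ j)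
        meet = trans (prefix-vertexAt outer (toℕ i) (ℕP.<⇒≤ i<j)) same
        loop = cast-start meet (suffix inner)
        rest = cast-end meet (prefix inner) ++ʷ suffix outer
        a = length (prefix inner)
        b = length (suffix inner)
        c = length (suffix outer)
        a+b≡j : a + b ≡ toℕ j
        a+b≡j = trans (length-cut inner) (length-prefix outer)
        j+c≡length : toℕ j + c ≡ length w
        j+c≡length = trans (cong (_+ c) (sym (length-prefix outer))) (length-cut outer)
        length-rest : length rest ≡ a + c
        length-rest = trans (length-++ _ (suffix outer)) (cong (_+ c) (length-cast-end meet (prefix inner)))
        rearrange : ∀ a b c → b + (a + c) ≡ (a + b) + c
        rearrange = solve-∀
        positive-summand : ∀ {m d e} → m + d ≡ e → m < e → 1 ≤ d
        positive-summand {m} {zero}  e m<e = ⊥-elim (ℕP.<-irrefl (trans (sym (ℕP.+-identityʳ m)) e) m<e)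
        positive-summand {d = suc d} _ _   = s≤s z≤n

      shorter-odd-closed-walk : ∀ {x} {w : Walk A x x} → Split w → parity (length w) ≡ true →
                                Σ (Fin k) λ v → Σ (Walk A v v) λ c → length c < length w × parity (length c) ≡ true
      shorter-odd-closed-walk {w = w} s odd with parity (length loop) in loop-parity
        where open Split s
      ... | true  = _ , loop , subst (length loop <_) length-split (ℕP.m<m+n (length loop) rest-nonempty) , loop-parity
        where open Split s
      ... | false = _ , rest , subst (length rest <_) length-split (ℕP.m<n+m (length rest) loop-nonempty) ,
                    trans (sym (cong (_xor parity (length rest)) loop-parity))
                          (trans (sym (parity-+ (length loop) (length rest))) (trans (cong parity length-split) odd))
        where open Split s

      -- A shortest odd closed walk has no repeated vertex.
      odd-closed-walk⇒cycle : ∀ {x} (w : Walk A x x) → parity (length w) ≡ true → HasCycle A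
      odd-closed-walk⇒cycle w = <-rec P recurse (length w) w refl
        where
        P : ℕ → Set
        P L = ∀ {x} (w : Walk A x x) → length w ≡ L → parity L ≡ true → HasCycle A
        recurse : ∀ L → (∀ {L'} → L' < L → P L') → P L
        recurse L shorter w refl odd with repetition? w
        ... | no simple = simple-closed-walk⇒cycle w simple odd
        ... | yes r = let _ , c , c<w , c-odd = shorter-odd-closed-walk (split-at-repetition w r) odd
                      in shorter c<w c refl c-odd

  module Colouring (T : RootedTree) where
    open RootedTree T

    reverse : ∀ {x y} → Walk TAdj x y → Walk TAdj y x
    reverse (here x)       = here x
    reverse (step {x} a w) = reverse w ++ʷ step (symmetric _ _ a) (here x)

    length-reverse : ∀ {x y} (w : Walk TAdj x y) → length (reverse w) ≡ length w
    length-reverse (here x)       = refl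
    length-reverse (step {x} a w) = trans (length-++ (reverse w) (step (symmetric _ _ a) (here x)))
                                      (trans (ℕP.+-comm (length (reverse w)) 1) (cong suc (length-reverse w)))

    closed-walk-even : ∀ {x} (w : Walk TAdj x x) → parity (length w) ≡ false
    closed-walk-even w with parity (length w) in odd
    ... | false = refl
    ... | true  = ⊥-elim (acyclic (odd-closed-walk⇒cycle irreflex w odd))

    colour : Fin size → Bool
    colour x = parity (length (connected root x))

    colour-root : colour root ≡ false
    colour-root = closed-walk-even (connected root root)

    colour-adjacent : ∀ x y → TAdj x y → colour y ≡ not (colour x)
    colour-adjacent x y a = xor-not-false (colour x) (colour y) (begin
        colour x xor not (colour y)                  ≡⟨ parity-+ (length to-x) (suc (length to-y)) ⟨
        parity (length to-x + suc (length to-y))     ≡⟨ cong parity length-around ⟨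
        parity (length around)                       ≡⟨ closed-walk-even around ⟩
        false                                        ∎)
      where
      open ≡-Reasoning
      to-x = connected root x
      to-y = connected root y
      around = to-x ++ʷ step a (reverse to-y)
      length-around : length around ≡ length to-x + suc (length to-y)
      length-around = trans (length-++ to-x _) (cong (λ l → length to-x + suc l) (length-reverse to-y))
      xor-not-false : ∀ p q → p xor not q ≡ false → q ≡ not p
      xor-not-false true  true  ()
      xor-not-false true  false _ = refl
      xor-not-false false true  _ = refl
      xor-not-false false false ()

module DerivedGraphs where

  open Congruences
  open DigraphAlgebra
  open import Data.Nat using (ℕ; NonZero)
  open import Data.Integer using (ℤ; +_; _+_; _*_; -_; _-_)
  import Data.Integer.Properties as ℤP
  open import Data.Integer.Tactic.RingSolver using (solve-∀)
  open import Data.Fin using (Fin)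
  open import Data.Product using (Σ; _,_; _×_; proj₁; proj₂)
  open import Function.Bundles using (Equivalence)
  open import Relation.Binary.PropositionalEquality

  open Digraph

  module Voltages (n : ℕ) .{{_ : NonZero n}} where
    open Modulo n
    open Products n

    Voltage : Digraph → Set
    Voltage D = ∀ u v → Arc D u v → ℤ

    Derived : (D : Digraph) → Voltage D → Digraph
    Derived D σ = record
      { V   = V D × Fin n
      ; Arc = λ p p' → Σ (Arc D (proj₁ p) (proj₁ p')) λ a → Shift (proj₂ p) (proj₂ p') (σ _ _ a) }

    affine : ℤ → ℤ → Fin n → Fin n
    affine h s q = reduce (ι q * h + s)

    affine-∘ : ∀ h s h' s' q → affine h' s' (affine h s q) ≡ affine (h * h') (s * h' + s') q
    affine-∘ h s h' s' q = reduce-cong (begin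
        ι (affine h s q) * h' + s'      ≈⟨ +-cong-≡ₙ (*-congʳ-≡ₙ h' (ι-reduce (ι q * h + s))) (≡ₙ-refl {s'}) ⟩
        (ι q * h + s) * h' + s'         ≡⟨ identity (ι q) h s h' s' ⟩
        ι q * (h * h') + (s * h' + s')  ∎)
      where
      open ≡ₙ-Reasoning
      identity : ∀ x h s h' s' → (x * h + s) * h' + s' ≡ x * (h * h') + (s * h' + s')
      identity = solve-∀

    affine-id : ∀ {h s} q → h ≡ₙ + 1 → s ≡ₙ + 0 → affine h s q ≡ q
    affine-id {h} {s} q h≡1 s≡0 = ι-injective (begin
        ι (affine h s q)   ≈⟨ ι-reduce (ι q * h + s) ⟩
        ι q * h + s        ≈⟨ +-cong-≡ₙ (*-congˡ-≡ₙ (ι q) h≡1) s≡0 ⟩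
        ι q * + 1 + + 0    ≡⟨ identity (ι q) ⟩
        ι q                ∎)
      where
      open ≡ₙ-Reasoning
      identity : ∀ x → x * + 1 + + 0 ≡ x
      identity = solve-∀

    affine-inverse : ∀ {h s h' s'} q → h * h' ≡ₙ + 1 → s * h' + s' ≡ₙ + 0 → affine h' s' (affine h s q) ≡ q
    affine-inverse q hh'≡1 offset≡0 = trans (affine-∘ _ _ _ _ q) (affine-id q hh'≡1 offset≡0)

    affine-cancelʳ : ∀ {h h'} → h * h' ≡ₙ + 1 → ∀ s q → affine h' (- (s * h')) (affine h s q) ≡ q
    affine-cancelʳ {h} {h'} hh'≡1 s q = affine-inverse q hh'≡1 (≡ₙ-reflexive (ℤP.+-inverseʳ (s * h')))

    affine-cancelˡ : ∀ {h h'} → h * h' ≡ₙ + 1 → ∀ s t → affine h s (affine h' (- (s * h')) t) ≡ t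
    affine-cancelˡ {h} {h'} hh'≡1 s t = affine-inverse t h'h≡1 (begin
        - (s * h') * h + s   ≡⟨ identity s h' h ⟩
        - s * (h' * h) + s   ≈⟨ +-cong-≡ₙ (*-congˡ-≡ₙ (- s) h'h≡1) (≡ₙ-refl {s}) ⟩
        - s * + 1 + s        ≡⟨ identity′ s ⟩
        + 0                  ∎)
      where
      open ≡ₙ-Reasoning
      h'h≡1 : h' * h ≡ₙ + 1
      h'h≡1 = subst (_≡ₙ + 1) (ℤP.*-comm h h') hh'≡1
      identity : ∀ a h' h → - (a * h') * h + a ≡ - a * (h' * h) + a
      identity = solve-∀
      identity′ : ∀ a → - a * + 1 + a ≡ + 0
      identity′ = solve-∀

    Shift-affine : ∀ h {s s' q q' d} → Shift q q' d → Shift (affine h s q) (affine h s' q') (d * h + (s' - s))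
    Shift-affine h {s} {s'} {q} {q'} {d} (shift sh) = shift (begin
        ι (affine h s' q')                     ≈⟨ ι-reduce (ι q' * h + s') ⟩
        ι q' * h + s'                          ≈⟨ +-cong-≡ₙ (*-congʳ-≡ₙ h sh) (≡ₙ-refl {s'}) ⟩
        (ι q + d) * h + s'                     ≡⟨ identity (ι q) d h s s' ⟩
        (ι q * h + s) + (d * h + (s' - s))     ≈⟨ +-cong-≡ₙ (≡ₙ-sym (ι-reduce (ι q * h + s))) ≡ₙ-refl ⟩
        ι (affine h s q) + (d * h + (s' - s))  ∎)
      where
      open ≡ₙ-Reasoning
      identity : ∀ x d h s s' → (x + d) * h + s' ≡ (x * h + s) + (d * h + (s' - s))
      identity = solve-∀

    Derived-affine : ∀ D σ {h h'} → h * h' ≡ₙ + 1 → (s : V D → ℤ) →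
                     Derived D σ ≅ᴰ Derived D (λ u v a → σ u v a * h + (s v - s u))
    Derived-affine D σ {h} {h'} hh'≡1 s = iso f g fg gf fw bw
      where
      τ : Voltage D
      τ u v a = σ u v a * h + (s v - s u)
      f : V D × Fin n → V D × Fin n
      f (u , q) = u , affine h (s u) q
      g : V D × Fin n → V D × Fin n
      g (u , t) = u , affine h' (- (s u * h')) t
      gf-fin : ∀ u q → affine h' (- (s u * h')) (affine h (s u) q) ≡ q
      gf-fin u = affine-cancelʳ hh'≡1 (s u)
      fg-fin : ∀ u t → affine h (s u) (affine h' (- (s u * h')) t) ≡ t
      fg-fin u = affine-cancelˡ hh'≡1 (s u)
      fg : ∀ p → f (g p) ≡ p
      fg (u , t) = cong (u ,_) (fg-fin u t)
      gf : ∀ p → g (f p) ≡ p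
      gf (u , q) = cong (u ,_) (gf-fin u q)
      fw : ∀ p p' → Arc (Derived D σ) p p' → Arc (Derived D τ) (f p) (f p')
      fw _ _ (a , sh) = a , Shift-affine h sh
      bw : ∀ p p' → Arc (Derived D τ) (f p) (f p') → Arc (Derived D σ) p p'
      bw (u , q) (v , q') (a , sh) =
        a , subst₂ (λ t t' → Shift t t' (σ u v a)) (gf-fin u q) (gf-fin v q')
              (Shift-cong (begin
                 (σ u v a * h + (s v - s u)) * h' + (- (s v * h') - - (s u * h'))
                   ≡⟨ identity (σ u v a) h h' (s u) (s v) ⟩
                 σ u v a * (h * h')
                   ≈⟨ *-congˡ-≡ₙ (σ u v a) hh'≡1 ⟩
                 σ u v a * + 1
                   ≡⟨ ℤP.*-identityʳ (σ u v a) ⟩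
                 σ u v a ∎)
                (Shift-affine h' sh))
        where
        open ≡ₙ-Reasoning
        identity : ∀ x h h' a b → (x * h + (b - a)) * h' + (- (b * h') - - (a * h')) ≡ x * (h * h')
        identity = solve-∀

    Derived-cong : ∀ D {σ τ} → (∀ u v a → σ u v a ≡ₙ τ u v a) → Derived D σ ≅ᴰ Derived D τ
    Derived-cong D σ≡τ = iso (λ p → p) (λ p → p) (λ _ → refl) (λ _ → refl)
      (λ { (u , _) (v , _) (a , sh) → a , Shift-cong (σ≡τ u v a) sh })
      (λ { (u , _) (v , _) (a , sh) → a , Shift-cong (≡ₙ-sym (σ≡τ u v a)) sh })

    ⊗≅Derived : ∀ D (ℓ : ELabel D) → D ⊗ ℓ ≅ᴰ Derived D (λ u v _ → sign (ℓ u v))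
    ⊗≅Derived D ℓ = iso (λ p → p) (λ p → p) (λ _ → refl) (λ _ → refl)
      (λ { (u , _) (v , _) (a , c) → a , Equivalence.to (CycDir⇔Shift (ℓ u v)) c })
      (λ { (u , _) (v , _) (a , sh) → a , Equivalence.from (CycDir⇔Shift (ℓ u v)) sh })

    Derived-trivial : ∀ D {σ} → (∀ u v a → σ u v a ≡ₙ + 0) → Derived D σ ≅ᴰ Copies n D
    Derived-trivial D {σ} σ≡0 = iso f g (λ _ → refl) (λ _ → refl) fw bw
      where
      f : V D × Fin n → Fin n × V D
      f (u , q) = q , u
      g : Fin n × V D → V D × Fin n
      g (q , u) = u , q
      fw : ∀ p p' → Arc (Derived D σ) p p' → Arc (Copies n D) (f p) (f p')
      fw (u , q) (v , q') (a , sh) =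
        subst (λ t → Arc (Copies n D) (q , u) (t , v)) (Equivalence.to (Shift-zero⇔≡ (σ≡0 u v a)) sh) (inside q a)
      bw : ∀ p p' → Arc (Copies n D) (f p) (f p') → Arc (Derived D σ) p p'
      bw (u , q) (v , q') arc with constant-arc arc
      ... | q≡q' , a = a , Equivalence.from (Shift-zero⇔≡ (σ≡0 u v a)) q≡q'

module UnicyclicDigraphs where

  open DigraphAlgebra
  open import Data.Nat using (ℕ)
  open import Data.Fin as F using (Fin)
  import Data.Fin.Properties as FP
  open import Data.Bool using (Bool; true; false)
  open import Data.Product using (Σ; _,_; _×_)
  open import Data.Sum using (_⊎_; inj₁; inj₂)
  open import Function using (_∘_)
  open import Relation.Binary.PropositionalEquality
  open import Relation.Binary.PropositionalEquality.Properties using (subst-sym-subst; subst-subst-sym)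

  open Graph
  open Digraph
  open RootedTree
  open Orientation

  module _ {L : ℕ} {U : Fin L → RootedTree} {Or : (J : Fin L) → Orientation (U J)} where

    D1-und : ∀ dir → und (D1 L U Or dir) ≅ᴳ Unicyclic L U
    D1-und dir = iso (λ u → u) (λ u → u) (λ _ → refl) (λ _ → refl) fw bw
      where
      as-adjacent : ∀ d {J J'} → CycDir L d J J' → CycAdj L J J'
      as-adjacent true  c = inj₁ c
      as-adjacent false c = inj₂ c
      orient : ∀ d {J J'} → CycAdj L J J' → CycDir L d J J' ⊎ CycDir L d J' J
      orient true  c = c
      orient false c = Data.Sum.swap c
      fw : ∀ u v → Adj (und (D1 L U Or dir)) u v → UAdj L U u v
      fw _ _ (inj₁ (tree j x y o)) = tree j x y (sound (Or j) x y o)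
      fw _ _ (inj₂ (tree j x y o)) = tree j y x (symmetric (U j) x y (sound (Or j) x y o))
      fw _ _ (inj₁ (cyc j j' c))   = cyc j j' (as-adjacent dir c)
      fw _ _ (inj₂ (cyc j j' c))   = cyc j' j (Data.Sum.swap (as-adjacent dir c))
      bw : ∀ u v → UAdj L U u v → Adj (und (D1 L U Or dir)) u v
      bw _ _ (tree j x y t) with covers (Or j) x y t
      ... | inj₁ o = inj₁ (tree j x y o)
      ... | inj₂ o = inj₂ (tree j y x o)
      bw _ _ (cyc j j' a) with orient dir a
      ... | inj₁ c = inj₁ (cyc j j' c)
      ... | inj₂ c = inj₂ (cyc j' j c)

    TreeArc : ∀ {J J'} → J ≡ J' → Fin (size (U J)) → Fin (size (U J')) → Set
    TreeArc {J} refl x x' = Orientation.O (Or J) x x'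

    -- The arcs of D1 with the equations between their endpoints made explicit, so that arcs can be transported
    -- along vertex maps that are not built from constructors.
    FlatArc : Bool → UVert L U → UVert L U → Set
    FlatArc dir (J , x) (J' , x') =
      (Σ (J ≡ J') λ e → TreeArc e x x') ⊎ ((x ≡ root (U J)) × (x' ≡ root (U J')) × CycDir L dir J J')

    flatten : ∀ {dir} u v → D1Arc L U Or dir u v → FlatArc dir u v
    flatten _ _ (tree j x y o) = inj₁ (refl , o)
    flatten _ _ (cyc j j' c)   = inj₂ (refl , refl , c)

    unflatten : ∀ {dir} u v → FlatArc dir u v → D1Arc L U Or dir u v
    unflatten (J , x) (.J , x') (inj₁ (refl , o)) = tree J x x' o
    unflatten (J , _) (J' , _)  (inj₂ (refl , refl , c)) = cyc J J' c

  module _ {X : Set} (T : X → RootedTree) (O : ∀ x → Orientation (T x)) (dir : Bool) where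

    private
      P : X → Set
      P x = Fin (size (T x))

      transport-arc : ∀ {a b} (e : a ≡ b) x y →
                      Orientation.O (O a) x y → Orientation.O (O b) (subst P e x) (subst P e y)
      transport-arc refl x y o = o

      transport-root : ∀ {a b} (e : a ≡ b) → subst P e (root (T a)) ≡ root (T b)
      transport-root refl = refl

    D1-pointwise : ∀ L (ρ₁ ρ₂ : Fin L → X) → (∀ i → ρ₂ i ≡ ρ₁ i) →
                   D1 L (T ∘ ρ₁) (O ∘ ρ₁) dir ≅ᴰ D1 L (T ∘ ρ₂) (O ∘ ρ₂) dir
    D1-pointwise L ρ₁ ρ₂ p = iso f g fg gf fw bw
      where
      f : UVert L (T ∘ ρ₁) → UVert L (T ∘ ρ₂)
      f (i , x) = i , subst P (sym (p i)) x
      g : UVert L (T ∘ ρ₂) → UVert L (T ∘ ρ₁)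
      g (i , y) = i , subst P (p i) y
      fg : ∀ u → f (g u) ≡ u
      fg (i , y) = cong (i ,_) (subst-sym-subst (p i))
      gf : ∀ u → g (f u) ≡ u
      gf (i , x) = cong (i ,_) (subst-subst-sym (p i))
      to-root : ∀ {i x} → x ≡ root (T (ρ₁ i)) → subst P (sym (p i)) x ≡ root (T (ρ₂ i))
      to-root {i} refl = transport-root (sym (p i))
      from-root : ∀ {i x} → subst P (sym (p i)) x ≡ root (T (ρ₂ i)) → x ≡ root (T (ρ₁ i))
      from-root {i} e = trans (sym (subst-subst-sym (p i))) (trans (cong (subst P (p i)) e) (transport-root (p i)))
      flat-to : ∀ u v → FlatArc dir u v → FlatArc dir (f u) (f v)
      flat-to (i , x) (.i , y) (inj₁ (refl , o)) = inj₁ (refl , transport-arc (sym (p i)) x y o)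
      flat-to (i , x) (i' , y) (inj₂ (ex , ey , c)) = inj₂ (to-root ex , to-root ey , c)
      flat-from : ∀ u v → FlatArc dir (f u) (f v) → FlatArc dir u v
      flat-from (i , x) (.i , y) (inj₁ (refl , o)) =
        inj₁ (refl , subst₂ (Orientation.O (O (ρ₁ i))) (subst-subst-sym (p i)) (subst-subst-sym (p i))
                              (transport-arc (p i) _ _ o))
      flat-from (i , x) (i' , y) (inj₂ (ex , ey , c)) = inj₂ (from-root ex , from-root ey , c)
      fw : ∀ u v → D1Arc L (T ∘ ρ₁) (O ∘ ρ₁) dir u v → D1Arc L (T ∘ ρ₂) (O ∘ ρ₂) dir (f u) (f v)
      fw u v a = unflatten (f u) (f v) (flat-to u v (flatten u v a))
      bw : ∀ u v → D1Arc L (T ∘ ρ₂) (O ∘ ρ₂) dir (f u) (f v) → D1Arc L (T ∘ ρ₁) (O ∘ ρ₁) dir u v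
      bw u v a = unflatten u v (flat-from u v (flatten (f u) (f v) a))

    D1-cast : ∀ {L₁ L₂} (e : L₁ ≡ L₂) (ρ₁ : Fin L₁ → X) (ρ₂ : Fin L₂ → X) →
              (∀ i → ρ₂ (F.cast e i) ≡ ρ₁ i) →
              D1 L₁ (T ∘ ρ₁) (O ∘ ρ₁) dir ≅ᴰ D1 L₂ (T ∘ ρ₂) (O ∘ ρ₂) dir
    D1-cast {L} refl ρ₁ ρ₂ h = D1-pointwise L ρ₁ ρ₂ (λ i → trans (cong ρ₂ (sym (FP.cast-is-id refl i))) (h i))

module CyclicCovers where

  open Congruences
  open DigraphAlgebra
  open DerivedGraphs
  open UnicyclicDigraphs
  open import Data.Nat as ℕ using (ℕ; suc; _+_; _*_; _<_; NonZero)
  import Data.Nat.Properties as ℕP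
  open import Data.Nat.DivMod using (_%_; [m+kn]%n≡m%n; m<n⇒m%n≡m)
  open import Data.Integer as ℤ using (ℤ; -_)
  import Data.Integer.Properties as ℤP
  open import Data.Fin as F using (Fin; toℕ)
  import Data.Fin.Properties as FP
  open import Data.Product using (Σ; _,_; _×_; proj₁; proj₂)
  open import Data.Sum using (_⊎_; inj₁; inj₂)
  open import Data.Empty using (⊥-elim)
  open import Data.Bool using (Bool; true; false)
  open import Function.Bundles using (_⇔_; mk⇔; Equivalence)
  open import Relation.Binary.PropositionalEquality

  open Digraph
  open RootedTree

  *+-unique : ∀ L .{{_ : NonZero L}} {q q' r r'} → r < L → r' < L → L * q + r ≡ L * q' + r' → q ≡ q' × r ≡ r'
  *+-unique L {q} {q'} {r} {r'} r<L r'<L e = q≡q' , r≡r'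
    where
    swap : ∀ q r → L * q + r ≡ r + q * L
    swap q r = trans (ℕP.+-comm (L * q) r) (cong (r +_) (ℕP.*-comm L q))
    r≡r' : r ≡ r'
    r≡r' = begin
      r                  ≡⟨ m<n⇒m%n≡m r<L ⟨
      r % L              ≡⟨ [m+kn]%n≡m%n r q L ⟨
      (r + q * L) % L    ≡⟨ cong (_% L) (trans (sym (swap q r)) (trans e (swap q' r'))) ⟩
      (r' + q' * L) % L  ≡⟨ [m+kn]%n≡m%n r' q' L ⟩
      r' % L             ≡⟨ m<n⇒m%n≡m r'<L ⟩
      r'                 ∎
      where open ≡-Reasoning
    q≡q' : q ≡ q'
    q≡q' = ℕP.*-cancelˡ-≡ q q' L (ℕP.+-cancelʳ-≡ r (L * q) (L * q') (trans e (cong (L * q' +_) (sym r≡r'))))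

  *+-suc : ∀ L q r → suc r ≡ L → suc (L * q + r) ≡ L * suc q
  *+-suc L q r r+1≡L = begin
    suc (L * q + r)  ≡⟨ ℕP.+-suc (L * q) r ⟨
    L * q + suc r    ≡⟨ cong (L * q +_) r+1≡L ⟩
    L * q + L        ≡⟨ ℕP.+-comm (L * q) L ⟩
    L + L * q        ≡⟨ ℕP.*-suc L q ⟨
    L * suc q        ∎
    where open ≡-Reasoning

  *+-successor : ∀ L .{{_ : NonZero L}} {q r q' r'} → r < L → r' < L → suc (L * q + r) ≡ L * q' + r' →
                 (suc r ≡ r' × q ≡ q') ⊎ ((suc r ≡ L × r' ≡ 0) × suc q ≡ q')
  *+-successor L {q} {r} {q'} {r'} r<L r'<L e with ℕP.m≤n⇒m<n∨m≡n r<L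
  ... | inj₁ r+1<L = let q≡q' , r+1≡r' = *+-unique L r+1<L r'<L (trans (ℕP.+-suc (L * q) r) e)
                     in inj₁ (r+1≡r' , q≡q')
  ... | inj₂ r+1≡L = let q+1≡q' , 0≡r' = *+-unique L (ℕ.>-nonZero⁻¹ L) r'<L
                                            (trans (ℕP.+-identityʳ (L * suc q)) (trans (sym (*+-suc L q r r+1≡L)) e))
                     in inj₂ ((r+1≡L , sym 0≡r') , q+1≡q')

  *+-last : ∀ n L {q r} → q < n → r < L → suc (L * q + r) ≡ n * L → suc r ≡ L × suc q ≡ n
  *+-last n L {q} {r} q<n r<L e with ℕP.m≤n⇒m<n∨m≡n r<L
  ... | inj₂ r+1≡L = r+1≡L , ℕP.*-cancelˡ-≡ (suc q) n L {{nonZero}}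
                               (trans (sym (*+-suc L q r r+1≡L)) (trans e (ℕP.*-comm n L)))
    where
    nonZero : NonZero L
    nonZero = ℕ.>-nonZero (ℕP.≤-<-trans ℕ.z≤n r<L)
  ... | inj₁ r+1<L = ⊥-elim (ℕP.<-irrefl e (begin-strict
      suc (L * q + r)  ≡⟨ ℕP.+-suc (L * q) r ⟨
      L * q + suc r    <⟨ ℕP.+-monoʳ-< (L * q) r+1<L ⟩
      L * q + L        ≡⟨ trans (ℕP.+-comm (L * q) L) (sym (ℕP.*-suc L q)) ⟩
      L * suc q        ≤⟨ ℕP.*-monoʳ-≤ L q<n ⟩
      L * n            ≡⟨ ℕP.*-comm L n ⟩
      n * L            ∎))
    where open ℕP.≤-Reasoning

  module CyclicCover (n L : ℕ) .{{_ : NonZero n}} .{{_ : NonZero L}} where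
    open Modulo n

    crossing : ∀ {J J'} → CycArc L J J' → ℤ
    crossing (inj₁ _) = ℤ.+ 0
    crossing (inj₂ _) = ℤ.+ 1

    private
      t-combine : ∀ (a : Fin n) (b : Fin L) → toℕ (F.combine a b) ≡ L * toℕ a + toℕ b
      t-combine = FP.toℕ-combine

    CycArc-combine⁺ : ∀ {q q' : Fin n} {J J' : Fin L} →
                      CycArc (n * L) (F.combine q J) (F.combine q' J') → Σ (CycArc L J J') λ c → Shift q q' (crossing c)
    CycArc-combine⁺ {q} {q'} {J} {J'} (inj₁ e)
      with *+-successor L (FP.toℕ<n J) (FP.toℕ<n J') (trans (cong suc (sym (t-combine q J))) (trans e (t-combine q' J')))
    ... | inj₁ (J+1≡J' , q≡q') = inj₁ J+1≡J' , Equivalence.from (Shift-zero⇔≡ ≡ₙ-refl) (FP.toℕ-injective q≡q')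
    ... | inj₂ (last , q+1≡q') = inj₂ last , Equivalence.to CycArc⇔Shift (inj₁ q+1≡q')
    CycArc-combine⁺ {q} {q'} {J} {J'} (inj₂ (e , e')) =
      inj₂ (J+1≡L , J'≡0) , Equivalence.to CycArc⇔Shift (inj₂ (q+1≡n , q'≡0))
      where
      sum≡0 : L * toℕ q' + toℕ J' ≡ 0
      sum≡0 = trans (sym (t-combine q' J')) e'
      J'≡0 : toℕ J' ≡ 0
      J'≡0 = ℕP.m+n≡0⇒n≡0 (L * toℕ q') sum≡0
      q'≡0 : toℕ q' ≡ 0
      q'≡0 with ℕP.m*n≡0⇒m≡0∨n≡0 L (ℕP.m+n≡0⇒m≡0 (L * toℕ q') sum≡0)
      ... | inj₁ L≡0 = ⊥-elim (ℕ.≢-nonZero⁻¹ L L≡0)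
      ... | inj₂ q'≡0 = q'≡0
      last = *+-last n L (FP.toℕ<n q) (FP.toℕ<n J) (trans (cong suc (sym (t-combine q J))) e)
      J+1≡L = proj₁ last
      q+1≡n = proj₂ last

    CycArc-combine⁻ : ∀ {q q' : Fin n} {J J' : Fin L} →
                      (Σ (CycArc L J J') λ c → Shift q q' (crossing c)) → CycArc (n * L) (F.combine q J) (F.combine q' J')
    CycArc-combine⁻ {q} {q'} {J} {J'} (inj₁ J+1≡J' , sh) with Equivalence.to (Shift-zero⇔≡ ≡ₙ-refl) sh
    ... | refl = inj₁ (begin
      suc (toℕ (F.combine q J))   ≡⟨ cong suc (t-combine q J) ⟩
      suc (L * toℕ q + toℕ J)     ≡⟨ ℕP.+-suc (L * toℕ q) (toℕ J) ⟨
      L * toℕ q + suc (toℕ J)     ≡⟨ cong (λ r → L * toℕ q + r) J+1≡J' ⟩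
      L * toℕ q + toℕ J'          ≡⟨ t-combine q J' ⟨
      toℕ (F.combine q J')        ∎)
      where open ≡-Reasoning
    CycArc-combine⁻ {q} {q'} {J} {J'} (inj₂ (J+1≡L , J'≡0) , sh) with Equivalence.from CycArc⇔Shift sh
    ... | inj₁ q+1≡q' = inj₁ (begin
      suc (toℕ (F.combine q J))   ≡⟨ cong suc (t-combine q J) ⟩
      suc (L * toℕ q + toℕ J)     ≡⟨ *+-suc L (toℕ q) (toℕ J) J+1≡L ⟩
      L * suc (toℕ q)             ≡⟨ cong (L *_) q+1≡q' ⟩
      L * toℕ q'                  ≡⟨ ℕP.+-identityʳ (L * toℕ q') ⟨
      L * toℕ q' + 0              ≡⟨ cong (λ r → L * toℕ q' + r) J'≡0 ⟨
      L * toℕ q' + toℕ J'         ≡⟨ t-combine q' J' ⟨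
      toℕ (F.combine q' J')       ∎)
      where open ≡-Reasoning
    ... | inj₂ (q+1≡n , q'≡0) = inj₂ (wraps , lands-at-zero)
      where
      open ≡-Reasoning
      wraps : suc (toℕ (F.combine q J)) ≡ n * L
      wraps = begin
        suc (toℕ (F.combine q J))   ≡⟨ cong suc (t-combine q J) ⟩
        suc (L * toℕ q + toℕ J)     ≡⟨ *+-suc L (toℕ q) (toℕ J) J+1≡L ⟩
        L * suc (toℕ q)             ≡⟨ cong (L *_) q+1≡n ⟩
        L * n                       ≡⟨ ℕP.*-comm L n ⟩
        n * L                       ∎
      lands-at-zero : toℕ (F.combine q' J') ≡ 0
      lands-at-zero = begin
        toℕ (F.combine q' J')       ≡⟨ t-combine q' J' ⟩
        L * toℕ q' + toℕ J'         ≡⟨ cong₂ (λ a b → L * a + b) q'≡0 J'≡0 ⟩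
        L * 0 + 0                   ≡⟨ trans (ℕP.+-identityʳ (L * 0)) (ℕP.*-zeroʳ L) ⟩
        0                           ∎

    CycArc-combine : ∀ {q q' : Fin n} {J J' : Fin L} →
                     CycArc (n * L) (F.combine q J) (F.combine q' J') ⇔ Σ (CycArc L J J') λ c → Shift q q' (crossing c)
    CycArc-combine = mk⇔ CycArc-combine⁺ CycArc-combine⁻

  module Covering (n L : ℕ) .{{_ : NonZero n}} .{{_ : NonZero L}}
                  (U : Fin L → RootedTree) (Or : ∀ J → Orientation (U J)) where
    open Modulo n
    open Voltages n
    open CyclicCover n L

    cycle-voltage : ∀ dir {J J'} → CycDir L dir J J' → ℤ
    cycle-voltage true  c = crossing c
    cycle-voltage false c = - crossing c

    wrap : ∀ dir → Voltage (D1 L U Or dir)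
    wrap dir _ _ (tree _ _ _ _) = ℤ.+ 0
    wrap dir _ _ (cyc _ _ c)    = cycle-voltage dir c

    rem : Fin (n ℕ.* L) → Fin L
    rem = F.remainder {n} L

    quot : Fin (n ℕ.* L) → Fin n
    quot = F.quotient {n} L

    combine-remQuot : ∀ i → F.combine (quot i) (rem i) ≡ i
    combine-remQuot = FP.combine-remQuot {n} L

    CycArc-remQuot : ∀ {i i'} → CycArc (n ℕ.* L) i i' ⇔
                     Σ (CycArc L (rem i) (rem i')) λ c → Shift (quot i) (quot i') (crossing c)
    CycArc-remQuot {i} {i'} = mk⇔
      (λ c → Equivalence.to CycArc-combine (subst₂ (CycArc (n ℕ.* L)) (sym (combine-remQuot i)) (sym (combine-remQuot i')) c))
      (λ s → subst₂ (CycArc (n ℕ.* L)) (combine-remQuot i) (combine-remQuot i') (Equivalence.from CycArc-combine s))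

    CycDir-remQuot : ∀ dir {i i'} → CycDir (n ℕ.* L) dir i i' ⇔
                     Σ (CycDir L dir (rem i) (rem i')) λ c → Shift (quot i) (quot i') (cycle-voltage dir c)
    CycDir-remQuot true  = CycArc-remQuot
    CycDir-remQuot false = mk⇔
      (λ c → let c' , sh = Equivalence.to CycArc-remQuot c in c' , Shift-flip sh)
      (λ (c' , sh) → Equivalence.from CycArc-remQuot
                       (c' , Shift-cong (≡ₙ-reflexive (ℤP.neg-involutive (crossing c'))) (Shift-flip sh)))

    derived-arc : ∀ {dir u v q q'} (a : D1Arc L U Or dir u v) → Shift q q' (wrap dir u v a) →
                  (Σ (proj₁ u ≡ proj₁ v) λ e → TreeArc {U = U} {Or} e (proj₂ u) (proj₂ v) × q ≡ q') ⊎
                  ((proj₂ u ≡ root (U (proj₁ u))) × (proj₂ v ≡ root (U (proj₁ v))) ×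
                   Σ (CycDir L dir (proj₁ u) (proj₁ v)) λ c → Shift q q' (cycle-voltage dir c))
    derived-arc (tree j x y o) sh = inj₁ (refl , o , Equivalence.to (Shift-zero⇔≡ ≡ₙ-refl) sh)
    derived-arc (cyc j j' c)   sh = inj₂ (refl , refl , c , sh)

    cover : Bool → Digraph
    cover dir = D1 (n ℕ.* L) (λ i → U (rem i)) (λ i → Or (rem i)) dir

    cover≅Derived : ∀ dir → cover dir ≅ᴰ Derived (D1 L U Or dir) (wrap dir)
    cover≅Derived dir = iso f g fg gf fw bw
      where
      P : Fin L → Set
      P J = Fin (size (U J))
      rem-combine : ∀ q J → rem (F.combine q J) ≡ J
      rem-combine q J = cong proj₂ (FP.remQuot-combine q J)
      f : V (cover dir) → UVert L U × Fin n
      f (i , x) = (rem i , x) , quot i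
      g : UVert L U × Fin n → V (cover dir)
      g ((J , x) , q) = F.combine q J , subst P (sym (rem-combine q J)) x
      fg : ∀ p → f (g p) ≡ p
      fg ((J , x) , q) = cong₂ _,_ (transported (rem-combine q J) x) (cong proj₁ (FP.remQuot-combine q J))
        where
        transported : ∀ {J J'} (e : J ≡ J') (x : P J') → _≡_ {A = UVert L U} (J , subst P (sym e) x) (J' , x)
        transported refl x = refl
      gf : ∀ p → g (f p) ≡ p
      gf (i , x) = transported (combine-remQuot i) (rem-combine (quot i) (rem i)) x
        where
        transported : ∀ {i' i} (p : i' ≡ i) (e : rem i' ≡ rem i) (x : P (rem i)) →
                      _≡_ {A = V (cover dir)} (i' , subst P (sym e) x) (i , x)
        transported refl refl x = refl
      fw : ∀ p p' → Arc (cover dir) p p' → Arc (Derived (D1 L U Or dir) (wrap dir)) (f p) (f p')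
      fw _ _ (tree i x x' o) = tree (rem i) x x' o , Equivalence.from (Shift-zero⇔≡ ≡ₙ-refl) refl
      fw _ _ (cyc i i' c)    = let c' , sh = Equivalence.to (CycDir-remQuot dir) c in cyc (rem i) (rem i') c' , sh
      tree-back : ∀ {i i' x x'} → quot i ≡ quot i' → (e : rem i ≡ rem i') → TreeArc {U = U} {Or} e x x' →
                  Arc (cover dir) (i , x) (i' , x')
      tree-back {i} {i'} q≡q' e o
        with trans (sym (combine-remQuot i)) (trans (cong₂ F.combine q≡q' e) (combine-remQuot i'))
      tree-back {i} {.i} {x} {x'} q≡q' refl o | refl = tree i x x' o
      bw : ∀ p p' → Arc (Derived (D1 L U Or dir) (wrap dir)) (f p) (f p') → Arc (cover dir) p p'
      bw (i , x) (i' , x') (a , sh) with derived-arc {dir} {rem i , x} {rem i' , x'} {quot i} {quot i'} a sh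
      ... | inj₁ (e , o , q≡q')         = tree-back q≡q' e o
      ... | inj₂ (refl , refl , c , sh') = cyc i i' (Equivalence.from (CycDir-remQuot dir) (c , sh'))

module Labellings where

  open Congruences
  open DigraphAlgebra
  open DerivedGraphs
  open UnicyclicDigraphs
  open CyclicCovers
  open import Data.Nat as ℕ using (ℕ; zero; suc; NonZero)
  import Data.Nat.Properties as ℕP
  open import Data.Integer using (ℤ; +_; -_; _+_; _-_; _*_)
  import Data.Integer.Properties as ℤP
  open import Data.Fin using (Fin; toℕ)
  import Data.Fin.Properties as FP
  open import Data.Bool using (Bool; true; false; not)
  open import Data.Product using (_,_)
  open import Data.Sum using (inj₁; inj₂)
  open import Relation.Binary.PropositionalEquality
  open import Data.Integer.Tactic.RingSolver using (solve-∀)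
  open import Relation.Nullary using (¬_; yes; no)
  open OddCycles using (module Colouring; parity)

  open Digraph
  open RootedTree

  height : (ℕ → Bool) → ℕ → ℤ
  height s zero    = + 0
  height s (suc t) = height s t + sign (s t)

  bit : Bool → ℤ
  bit false = + 0
  bit true  = + 1

  height-suc : ∀ s t → height s (suc t) ≡ sign (s 0) + height (λ i → s (suc i)) t
  height-suc s zero    = ℤP.+-comm (+ 0) (sign (s 0))
  height-suc s (suc t) = trans (cong (_+ sign (s (suc t))) (height-suc s t))
                               (ℤP.+-assoc (sign (s 0)) (height (λ i → s (suc i)) t) (sign (s (suc t))))

  rise : ℕ → ℕ → Bool
  rise zero    t       = not (parity t)
  rise (suc k) zero    = true
  rise (suc k) (suc t) = rise k t

  height-rise : ∀ k u → height (rise k) (k ℕ.+ u) ≡ + k + bit (parity u)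
  height-rise zero    zero    = refl
  height-rise zero    (suc u) = trans (cong (_+ sign (not (parity u))) (height-rise zero u)) (flip (parity u))
    where
    flip : ∀ p → + 0 + bit p + sign (not p) ≡ + 0 + bit (not p)
    flip true  = refl
    flip false = refl
  height-rise (suc k) u = begin
      height (rise (suc k)) (suc k ℕ.+ u)  ≡⟨ height-suc (rise (suc k)) (k ℕ.+ u) ⟩
      + 1 + height (rise k) (k ℕ.+ u)      ≡⟨ cong (λ z → + 1 + z) (height-rise k u) ⟩
      + 1 + (+ k + bit (parity u))         ≡⟨ ℤP.+-assoc (+ 1) (+ k) (bit (parity u)) ⟨
      + suc k + bit (parity u)             ∎
    where open ≡-Reasoning

  module Labelling (n L : ℕ) .{{_ : NonZero n}} (2≤L : 2 ℕ.≤ L)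
                   (U : Fin L → RootedTree) (Or : ∀ J → Orientation (U J)) where

    private instance
      L-nonZero : NonZero L
      L-nonZero = ℕ.>-nonZero (ℕP.<-≤-trans (ℕ.s≤s ℕ.z≤n) 2≤L)

    open Modulo n
    open Voltages n
    open Products n
    open Covering n L U Or
    open Colouring using (colour; colour-root; colour-adjacent)

    -- The potential is
    -- the height of s at the tree's position on the cycle plus the colour, so that every voltage cancels except
    -- at the arc closing the cycle (label-voltage).
    potential : (ℕ → Bool) → UVert L U → ℤ
    potential s (J , x) = height s (toℕ J) + bit (colour (U J) x)

    cycle-label : Bool → (ℕ → Bool) → Fin L → Fin L → Bool
    cycle-label true  s J J' = s (toℕ J)
    cycle-label false s J J' = not (s (toℕ J'))

    label : ∀ dir → (ℕ → Bool) → ELabel (D1 L U Or dir)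
    label dir s (J , x) (J' , x') with J FP.≟ J'
    ... | yes _ = colour (U J') x'
    ... | no  _ = cycle-label dir s J J'

    cycle-irreflexive : ∀ dir {J} → ¬ CycDir L dir J J
    cycle-irreflexive dir {J} c = no-loop (as-arc dir c)
      where
      as-arc : ∀ d → CycDir L d J J → CycArc L J J
      as-arc true  c = c
      as-arc false c = c
      no-loop : ¬ CycArc L J J
      no-loop (inj₁ e)        = ℕP.1+n≢n e
      no-loop (inj₂ (e , e')) = ℕP.<-irrefl (trans (cong suc (sym e')) e) 2≤L

    label-tree : ∀ dir s J x x' → label dir s (J , x) (J , x') ≡ colour (U J) x'
    label-tree dir s J x x' rewrite ≡-≟-identity FP._≟_ {J} refl = refl

    label-cycle : ∀ dir s {J J'} x x' → J ≢ J' → label dir s (J , x) (J' , x') ≡ cycle-label dir s J J'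
    label-cycle dir s {J} {J'} x x' J≢J' rewrite ≢-≟-identity FP._≟_ J≢J' = refl

    potential-root : ∀ s J → potential s (J , root (U J)) ≡ height s (toℕ J)
    potential-root s J = trans (cong (λ c → height s (toℕ J) + bit c) (colour-root (U J))) (ℤP.+-identityʳ _)

    tree-voltage : ∀ c h H → sign (not c) + (h + bit c) - (h + bit (not c)) ≡ H * + 0
    tree-voltage true  = solve-∀
    tree-voltage false = solve-∀

    cycle-height : ∀ dir s {J J'} (c : CycDir L dir J J') →
                   sign (cycle-label dir s J J') + height s (toℕ J) - height s (toℕ J') ≡
                   height s L * cycle-voltage dir c
    cycle-height true s {J} (inj₁ J+1≡J') rewrite sym J+1≡J' =
      identity (sign (s (toℕ J))) (height s (toℕ J)) (height s L)
      where
      identity : ∀ d h H → d + h - (h + d) ≡ H * + 0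
      identity = solve-∀
    cycle-height true s {J} (inj₂ (J+1≡L , J'≡0)) rewrite J'≡0 =
      trans (identity (sign (s (toℕ J))) (height s (toℕ J))) (cong (λ t → height s t * + 1) J+1≡L)
      where
      identity : ∀ d h → d + h - + 0 ≡ (h + d) * + 1
      identity = solve-∀
    cycle-height false s {J' = J'} (inj₁ J'+1≡J) rewrite sym J'+1≡J | sign-not (s (toℕ J')) =
      identity (sign (s (toℕ J'))) (height s (toℕ J')) (height s L)
      where
      identity : ∀ d h H → - d + (h + d) - h ≡ H * - + 0
      identity = solve-∀
    cycle-height false s {J} {J'} (inj₂ (J'+1≡L , J≡0)) rewrite J≡0 | sign-not (s (toℕ J')) =
      trans (identity (sign (s (toℕ J'))) (height s (toℕ J'))) (cong (λ t → height s t * - + 1) J'+1≡L)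
      where
      identity : ∀ d h → - d + + 0 - h ≡ (h + d) * - + 1
      identity = solve-∀

    label-voltage : ∀ dir s u v (a : D1Arc L U Or dir u v) →
                    sign (label dir s u v) + potential s u - potential s v ≡ height s L * wrap dir u v a
    label-voltage dir s _ _ (tree J x x' o)
      rewrite label-tree dir s J x x' | colour-adjacent (U J) x x' (Orientation.sound (Or J) x x' o) =
      tree-voltage (colour (U J) x) (height s (toℕ J)) (height s L)
    label-voltage dir s _ _ (cyc J J' c)
      rewrite label-cycle dir s (root (U J)) (root (U J')) (λ { refl → cycle-irreflexive dir c })
            | potential-root s J | potential-root s J' = cycle-height dir s c

    ⊗label≅cover : ∀ dir s {h} → height s L * h ≡ₙ + 1 → D1 L U Or dir ⊗ label dir s ≅ᴰ cover dir
    ⊗label≅cover dir s {h} unit =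
      Iso-trans (⊗≅Derived _ (label dir s))
        (Iso-trans (Derived-affine _ _ {h} {height s L} unit′ (λ u → - (potential s u * h)))
          (Iso-trans (Derived-cong _ voltage≡wrap) (Iso-sym (cover≅Derived dir))))
      where
      unit′ : h * height s L ≡ₙ + 1
      unit′ = subst (_≡ₙ + 1) (ℤP.*-comm (height s L) h) unit
      voltage≡wrap : ∀ u v a →
                     sign (label dir s u v) * h + (- (potential s v * h) - - (potential s u * h)) ≡ₙ wrap dir u v a
      voltage≡wrap u v a = begin
        sign (label dir s u v) * h + (- (potential s v * h) - - (potential s u * h))
          ≡⟨ identity (sign (label dir s u v)) (potential s u) (potential s v) h ⟩
        (sign (label dir s u v) + potential s u - potential s v) * h
          ≡⟨ cong (_* h) (label-voltage dir s u v a) ⟩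
        height s L * wrap dir u v a * h
          ≡⟨ identity′ (height s L) (wrap dir u v a) h ⟩
        wrap dir u v a * (height s L * h)
          ≈⟨ *-congˡ-≡ₙ (wrap dir u v a) unit ⟩
        wrap dir u v a * + 1
          ≡⟨ ℤP.*-identityʳ (wrap dir u v a) ⟩
        wrap dir u v a ∎
        where
        open ≡ₙ-Reasoning
        identity : ∀ d a b h → d * h + (- (b * h) - - (a * h)) ≡ (d + a - b) * h
        identity = solve-∀
        identity′ : ∀ H w h → H * w * h ≡ w * (H * h)
        identity′ = solve-∀

    ⊗label≅Copies : ∀ dir s → height s L ≡ₙ + 0 → D1 L U Or dir ⊗ label dir s ≅ᴰ Copies n (D1 L U Or dir)
    ⊗label≅Copies dir s winding≡0 =
      Iso-trans (⊗≅Derived _ (label dir s))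
        (Iso-trans (Derived-affine _ _ {+ 1} {+ 1} ≡ₙ-refl (λ u → - potential s u))
          (Derived-trivial _ voltage≡0))
      where
      voltage≡0 : ∀ u v a → sign (label dir s u v) * + 1 + (- potential s v - - potential s u) ≡ₙ + 0
      voltage≡0 u v a = begin
        sign (label dir s u v) * + 1 + (- potential s v - - potential s u)
          ≡⟨ identity (sign (label dir s u v)) (potential s u) (potential s v) ⟩
        sign (label dir s u v) + potential s u - potential s v
          ≡⟨ label-voltage dir s u v a ⟩
        height s L * wrap dir u v a
          ≈⟨ *-congʳ-≡ₙ (wrap dir u v a) winding≡0 ⟩
        + 0 * wrap dir u v a
          ≡⟨ ℤP.*-zeroˡ (wrap dir u v a) ⟩
        + 0 ∎
        where
        open ≡ₙ-Reasoning
        identity : ∀ d a b → d * + 1 + (- b - - a) ≡ d + a - b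
        identity = solve-∀

module HornerRecurrence where

  open import Data.Nat as ℕ using (ℕ; zero; suc; NonZero; _<_; _≤_; _∸_; _^_)
  import Data.Nat.Properties as ℕP
  open import Data.Integer as ℤ using (ℤ; +_)
  import Data.Integer.Properties as ℤP
  open import Data.Integer.Tactic.RingSolver using (solve-∀)
  open import Data.Rational as ℚ using (ℚ; toℚᵘ)
  import Data.Rational.Properties as ℚP
  open import Data.Rational.Unnormalised as ℚᵘ using (ℚᵘ; mkℚᵘ; _≃_; *≡*; 0ℚᵘ; _+_; _*_; _/_)
  import Data.Rational.Unnormalised.Properties as ℚᵘP
  open import Data.Product using (Σ; _,_; _×_; proj₁; proj₂)
  open import Data.Empty using (⊥-elim)
  open import Relation.Nullary using (yes; no)
  open import Relation.Binary.PropositionalEquality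
  import Relation.Binary.Reasoning.Setoid as SetoidReasoning

  Σᵘ : ℕ → (ℕ → ℚᵘ) → ℚᵘ
  Σᵘ zero    f = 0ℚᵘ
  Σᵘ (suc k) f = Σᵘ k f + f k

  Σᵘ-cong : ∀ K {f g} → (∀ i → i < K → f i ≃ g i) → Σᵘ K f ≃ Σᵘ K g
  Σᵘ-cong zero    _   = ℚᵘP.≃-refl
  Σᵘ-cong (suc K) f≃g = ℚᵘP.+-cong (Σᵘ-cong K (λ i i<K → f≃g i (ℕP.m<n⇒m<1+n i<K))) (f≃g K ℕP.≤-refl)

  *-distribˡ-Σᵘ : ∀ c K f → c * Σᵘ K f ≃ Σᵘ K (λ i → c * f i)
  *-distribˡ-Σᵘ c zero    f = ℚᵘP.*-zeroʳ c
  *-distribˡ-Σᵘ c (suc K) f =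
    ℚᵘP.≃-trans (ℚᵘP.*-distribˡ-+ c (Σᵘ K f) (f K)) (ℚᵘP.+-congˡ (c * f K) (*-distribˡ-Σᵘ c K f))

  toℚᵘ-Σq : ∀ K f → toℚᵘ (Σq K f) ≃ Σᵘ K (λ i → toℚᵘ (f i))
  toℚᵘ-Σq zero    f = ℚᵘP.≃-refl
  toℚᵘ-Σq (suc K) f =
    ℚᵘP.≃-trans (ℚP.toℚᵘ-homo-+ (Σq K f) (f K)) (ℚᵘP.+-congˡ (toℚᵘ (f K)) (toℚᵘ-Σq K f))

  toℚᵘ-/ : ∀ i d .{{_ : NonZero d}} → toℚᵘ (i ℚ./ d) ≃ i / d
  toℚᵘ-/ i (suc d) = ℚP.toℚᵘ-fromℚᵘ (mkℚᵘ i d)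

  ιᵘ : ℕ → ℚᵘ
  ιᵘ x = + x / 1

  ιᵘ-+ : ∀ x y → ιᵘ x + ιᵘ y ≃ ιᵘ (x ℕ.+ y)
  ιᵘ-+ x y = *≡* (identity (+ x) (+ y))
    where
    identity : ∀ a b → (a ℤ.* + 1 ℤ.+ b ℤ.* + 1) ℤ.* + 1 ≡ (a ℤ.+ b) ℤ.* + 1
    identity = solve-∀

  ιᵘ-* : ∀ x y → ιᵘ x * ιᵘ y ≃ ιᵘ (x ℕ.* y)
  ιᵘ-* x y = *≡* (cong (ℤ._* + 1) (sym (ℤP.pos-* x y)))

  ιᵘ-injective : ∀ {x y} → ιᵘ x ≃ ιᵘ y → x ≡ y
  ιᵘ-injective {x} {y} (*≡* e) =
    ℤP.+-injective (trans (sym (ℤP.*-identityʳ (+ x))) (trans e (ℤP.*-identityʳ (+ y))))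

  private
    ↥-/ : ∀ i d .{{_ : NonZero d}} → ℚᵘ.↥ (i / d) ≡ i
    ↥-/ i (suc d) = refl

    ↧-/ : ∀ i d .{{_ : NonZero d}} → ℚᵘ.↧ (i / d) ≡ + d
    ↧-/ i (suc d) = refl

    ↥-* : ∀ p q → ℚᵘ.↥ (p * q) ≡ ℚᵘ.↥ p ℤ.* ℚᵘ.↥ q
    ↥-* (mkℚᵘ a b) (mkℚᵘ c d) = refl

    ↧-* : ∀ p q → ℚᵘ.↧ (p * q) ≡ ℚᵘ.↧ p ℤ.* ℚᵘ.↧ q
    ↧-* (mkℚᵘ a b) (mkℚᵘ c d) = ℤP.pos-* (suc b) (suc d)

  module Horner (n : ℕ) .{{_ : NonZero n}} (a : ℕ → ℕ) where

    term : ℕ → ℕ → ℚᵘ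
    term x e = _/_ (+ x) (n ^ e) {{ℕP.m^n≢0 n e}}

    partial : ℕ → ℚᵘ
    partial K = Σᵘ K (λ i → term (a i) (K ∸ i))

    n*term : ∀ x e → ιᵘ n * term x (suc e) ≃ term x e
    n*term x e = *≡* (begin
        ℚᵘ.↥ (ιᵘ n * term x (suc e)) ℤ.* ℚᵘ.↧ (term x e)  ≡⟨ cong₂ ℤ._*_ ↥-lhs (↧-/ (+ x) (n ^ e)) ⟩
        + n ℤ.* + x ℤ.* + (n ^ e)                           ≡⟨ identity (+ n) (+ x) (+ (n ^ e)) ⟩
        + x ℤ.* (+ 1 ℤ.* (+ n ℤ.* + (n ^ e)))              ≡⟨ cong₂ ℤ._*_ (sym (↥-/ (+ x) (n ^ e))) (sym ↧-lhs) ⟩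
        ℚᵘ.↥ (term x e) ℤ.* ℚᵘ.↧ (ιᵘ n * term x (suc e))  ∎)
      where
      open ≡-Reasoning
      instance
        _ = ℕP.m^n≢0 n e
        _ = ℕP.m^n≢0 n (suc e)
      identity : ∀ m y d → m ℤ.* y ℤ.* d ≡ y ℤ.* (+ 1 ℤ.* (m ℤ.* d))
      identity = solve-∀
      ↥-lhs : ℚᵘ.↥ (ιᵘ n * term x (suc e)) ≡ + n ℤ.* + x
      ↥-lhs = trans (↥-* (ιᵘ n) (term x (suc e))) (cong (+ n ℤ.*_) (↥-/ (+ x) (n ^ suc e)))
      ↧-lhs : ℚᵘ.↧ (ιᵘ n * term x (suc e)) ≡ + 1 ℤ.* (+ n ℤ.* + (n ^ e))
      ↧-lhs = trans (↧-* (ιᵘ n) (term x (suc e))) (cong (+ 1 ℤ.*_) (trans (↧-/ (+ x) (n ^ suc e)) (ℤP.pos-* n (n ^ e))))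

    horner : ∀ k → ιᵘ n * partial (suc k) ≃ partial k + ιᵘ (a k)
    horner k = begin
        ιᵘ n * partial (suc k)                             ≈⟨ *-distribˡ-Σᵘ (ιᵘ n) (suc k) _ ⟩
        Σᵘ (suc k) (λ i → ιᵘ n * term (a i) (suc k ∸ i))  ≈⟨ Σᵘ-cong (suc k) lower ⟩
        Σᵘ (suc k) (λ i → term (a i) (k ∸ i))             ≡⟨ cong (λ e → partial k + term (a k) e) (ℕP.n∸n≡0 k) ⟩
        partial k + ιᵘ (a k)                               ∎
      where
      open SetoidReasoning ℚᵘP.≃-setoid
      lower : ∀ i → i < suc k → ιᵘ n * term (a i) (suc k ∸ i) ≃ term (a i) (k ∸ i)
      lower i i<k+1 = subst (λ e → ιᵘ n * term (a i) e ≃ term (a i) (k ∸ i))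
                            (sym (ℕP.+-∸-assoc 1 (ℕP.≤-pred i<k+1))) (n*term (a i) (k ∸ i))

    toℚᵘ-divPow : ∀ x e → toℚᵘ (divPow x n e) ≃ term x e
    toℚᵘ-divPow x e = toℚᵘ-/ (+ x) (n ^ e) {{ℕP.m^n≢0 n e}}

    toℚᵘ-partial : ∀ K → toℚᵘ (Σq K (λ i → divPow (a i) n (K ∸ i))) ≃ partial K
    toℚᵘ-partial K = ℚᵘP.≃-trans (toℚᵘ-Σq K _) (Σᵘ-cong K (λ i _ → toℚᵘ-divPow (a i) (K ∸ i)))

    toℚᵘ-total : ∀ l → toℚᵘ (Σq (suc l) (λ i → divPow (a i) n (l ∸ i))) ≃ partial l + ιᵘ (a l)
    toℚᵘ-total l = ℚᵘP.≃-trans (toℚᵘ-Σq (suc l) _)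
                     (ℚᵘP.≃-trans (Σᵘ-cong (suc l) (λ i _ → toℚᵘ-divPow (a i) (l ∸ i)))
                                  (ℚᵘP.≃-reflexive (cong (λ e → partial l + term (a l) e) (ℕP.n∸n≡0 l))))

  integer-recurrence : ∀ l n .{{_ : NonZero n}} (a : ℕ → ℕ) →
      (l ≡ 0 → a 0 ≡ n) →
      (1 ≤ l → Σq (suc l) (λ i → divPow (a i) n (l ∸ i)) ≡ (+ n) ℚ./ 1) →
      (1 ≤ l → (k : ℕ) → k < l →
        Σ ℕ λ z → 1 ≤ z × (Σq (suc k) (λ i → divPow (a i) n (suc k ∸ i)) ≡ (+ z) ℚ./ 1)) →
      Σ (ℕ → ℕ) λ q → q 0 ≡ 0 × a l ℕ.+ q l ≡ n × (∀ i → i < l → n ℕ.* q (suc i) ≡ a i ℕ.+ q i)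
  integer-recurrence l n a l≡0⇒ total partial-integral = q , refl , top , q-recurrence
    where
    open Horner n a
    q : ℕ → ℕ
    q zero    = 0
    q (suc k) with k ℕ.<? l
    ... | yes k<l = proj₁ (partial-integral (ℕP.<-≤-trans (ℕ.s≤s ℕ.z≤n) k<l) k k<l)
    ... | no  _   = 0
    q-partial : ∀ K → K ≤ l → partial K ≃ ιᵘ (q K)
    q-partial zero    _   = ℚᵘP.≃-refl
    q-partial (suc k) k<l with k ℕ.<? l
    ... | yes k<l = ℚᵘP.≃-trans (ℚᵘP.≃-sym (toℚᵘ-partial (suc k)))
                      (ℚᵘP.≃-trans (ℚᵘP.≃-reflexive (cong toℚᵘ (proj₂ (proj₂ (partial-integral _ k k<l)))))
                                   (toℚᵘ-/ (+ _) 1))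
    ... | no  k≮l = ⊥-elim (k≮l k<l)
    q-recurrence : ∀ i → i < l → n ℕ.* q (suc i) ≡ a i ℕ.+ q i
    q-recurrence i i<l = trans (ιᵘ-injective (begin
        ιᵘ (n ℕ.* q (suc i))     ≈⟨ ιᵘ-* n (q (suc i)) ⟨
        ιᵘ n * ιᵘ (q (suc i))    ≈⟨ ℚᵘP.*-congˡ {ιᵘ n} (q-partial (suc i) i<l) ⟨
        ιᵘ n * partial (suc i)   ≈⟨ horner i ⟩
        partial i + ιᵘ (a i)     ≈⟨ ℚᵘP.+-congˡ (ιᵘ (a i)) (q-partial i (ℕP.<⇒≤ i<l)) ⟩
        ιᵘ (q i) + ιᵘ (a i)      ≈⟨ ιᵘ-+ (q i) (a i) ⟩
        ιᵘ (q i ℕ.+ a i)         ∎)) (ℕP.+-comm (q i) (a i))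
      where open SetoidReasoning ℚᵘP.≃-setoid
    top : a l ℕ.+ q l ≡ n
    top with l ℕ.≟ 0
    ... | yes l≡0 = subst (λ L → a L ℕ.+ q L ≡ n) (sym l≡0) (trans (ℕP.+-identityʳ (a 0)) (l≡0⇒ l≡0))
    ... | no  l≢0 = trans (ℕP.+-comm (a l) (q l)) (ιᵘ-injective (begin
        ιᵘ (q l ℕ.+ a l)                                    ≈⟨ ιᵘ-+ (q l) (a l) ⟨
        ιᵘ (q l) + ιᵘ (a l)                                 ≈⟨ ℚᵘP.+-congˡ (ιᵘ (a l)) (q-partial l ℕP.≤-refl) ⟨
        partial l + ιᵘ (a l)                                ≈⟨ toℚᵘ-total l ⟨
        toℚᵘ (Σq (suc l) (λ i → divPow (a i) n (l ∸ i)))   ≡⟨ cong toℚᵘ (total (ℕP.n≢0⇒n>0 l≢0)) ⟩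
        toℚᵘ ((+ n) ℚ./ 1)                                  ≈⟨ toℚᵘ-/ (+ n) 1 ⟩
        ιᵘ n                                                ∎))
      where open SetoidReasoning ℚᵘP.≃-setoid

module PowerSequences where

  open Congruences
  open DigraphAlgebra
  open UnicyclicDigraphs
  open Labellings
  open OddCycles using (parity; parity-+; parity-*; %2≡1⇒parity; parity⇒%2≡1)
  open import Data.Nat as ℕ using (ℕ; zero; suc; _+_; _*_; _^_; _∸_; _≤_; _<_; NonZero)
  import Data.Nat.Properties as ℕP
  open import Data.Nat.Tactic.RingSolver using (solve-∀)
  open import Data.Nat.DivMod using (_%_; _/_; m≡m%n+[m/n]*n; m<n⇒m%n≡m; [m+kn]%n≡m%n; m∣n⇒o%n%m≡o%m)
  open import Data.Nat.Divisibility using (divides)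
  open import Data.Integer as ℤ using (+_)
  import Data.Integer.Properties as ℤP
  open import Data.Fin as F using (Fin; toℕ)
  import Data.Fin.Properties as FP
  open import Data.Bool using (Bool; true; false; _xor_; _∧_)
  open import Data.Product using (Σ; _,_; _×_; proj₁)
  open import Data.Product.Properties using (≡-dec)
  open import Function using (_∘_)
  open import Data.Empty using (⊥-elim)
  open import Relation.Binary.PropositionalEquality

  open Digraph

  2≤m : ∀ {m n} → 3 ≤ n → 1 ≤ m → (m % 2 ≡ 1 → n ≤ m) → 2 ≤ m
  2≤m {suc zero}    3≤n _ 1-odd⇒n≤1 = ⊥-elim (ℕP.<⇒≱ (ℕP.<-≤-trans (ℕ.s≤s (ℕ.s≤s ℕ.z≤n)) 3≤n) (1-odd⇒n≤1 refl))
  2≤m {suc (suc _)} _   _ _         = ℕ.s≤s (ℕ.s≤s ℕ.z≤n)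

  module Powers (n m : ℕ) .{{_ : NonZero n}} (n%2≡1 : n % 2 ≡ 1) (m%2≡1⇒n≤m : m % 2 ≡ 1 → n ≤ m)
                (2≤m : 2 ≤ m) (T : Fin m → RootedTree) (O : ∀ j → Orientation (T j)) (dir : Bool) where
    open Modulo n
    open Products n

    n-odd : parity n ≡ true
    n-odd = %2≡1⇒parity n n%2≡1

    -- Power k orients G^{n^k}: its cycle has length n^k·m and position i carries T (i mod m) (Power-und).
    cycle-length : ℕ → ℕ
    cycle-length zero    = m
    cycle-length (suc k) = n * cycle-length k

    block : ∀ k → Fin (cycle-length k) → Fin m
    block zero    i = i
    block (suc k) i = block k (F.remainder {n} (cycle-length k) i)

    Power : ℕ → Digraph
    Power k = D1 (cycle-length k) (T ∘ block k) (O ∘ block k) dir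

    m≤cycle-length : ∀ k → m ≤ cycle-length k
    m≤cycle-length zero    = ℕP.≤-refl
    m≤cycle-length (suc k) = ℕP.≤-trans (m≤cycle-length k) (ℕP.m≤n*m (cycle-length k) n)

    parity-cycle-length : ∀ k → parity (cycle-length k) ≡ parity m
    parity-cycle-length zero    = refl
    parity-cycle-length (suc k) = trans (parity-* n (cycle-length k)) (cong₂ _∧_ n-odd (parity-cycle-length k))

    module Layer (k : ℕ) =
      Labelling n (cycle-length k) (ℕP.≤-trans 2≤m (m≤cycle-length k)) (T ∘ block k) (O ∘ block k)

    winding-rise : ∀ j L → j ≤ L → height (rise j) L ≡ + j ℤ.+ bit (parity (L ∸ j))
    winding-rise j L j≤L =
      subst (λ t → height (rise j) t ≡ + j ℤ.+ bit (parity (L ∸ j))) (ℕP.m+[n∸m]≡n j≤L) (height-rise j (L ∸ j))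

    parity-∸ : ∀ j L → j ≤ L → parity j xor parity (L ∸ j) ≡ parity L
    parity-∸ j L j≤L = trans (sym (parity-+ j (L ∸ j))) (cong parity (ℕP.m+[n∸m]≡n j≤L))

    n≡1+2h : n ≡ suc ((n / 2) * 2)
    n≡1+2h = trans (m≡m%n+[m/n]*n n 2) (cong (_+ (n / 2) * 2) n%2≡1)

    2-invertible : + 2 ℤ.* + suc (n / 2) ≡ₙ + 1
    2-invertible = ≡ₙ-trans (≡ₙ-reflexive (cong +_ (trans (identity (n / 2)) (cong suc (sym n≡1+2h)))))
                            (+-cong-≡ₙ (≡ₙ-refl {+ 1}) n≡ₙ0)
      where
      identity : ∀ h → 2 * suc h ≡ suc (suc (h * 2))
      identity = solve-∀

    grow-step : ∀ k → Reaches 1 (Power k) (Power (suc k))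
    grow-step k with parity (cycle-length k) in L-parity
    ... | true  = label dir (rise 0) , ⊗label≅cover dir (rise 0) {+ 1} (≡ₙ-reflexive (cong (ℤ._* + 1) winding≡1))
      where
      open Layer k
      L = cycle-length k
      winding≡1 : height (rise 0) L ≡ + 1
      winding≡1 = trans (winding-rise 0 L ℕ.z≤n) (cong (λ b → + 0 ℤ.+ bit b) L-parity)
    ... | false = label dir (rise 1) , ⊗label≅cover dir (rise 1) {+ suc (n / 2)}
                    (≡ₙ-trans (≡ₙ-reflexive (cong (ℤ._* + suc (n / 2)) winding≡2)) 2-invertible)
      where
      open Layer k
      L = cycle-length k
      1≤L : 1 ≤ L
      1≤L = ℕP.≤-trans (ℕP.≤-trans (ℕ.s≤s ℕ.z≤n) 2≤m) (m≤cycle-length k)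
      L-1-odd : parity (L ∸ 1) ≡ true
      L-1-odd with parity (L ∸ 1) | parity-∸ 1 L 1≤L
      ... | true  | _ = refl
      ... | false | e with () ← trans e L-parity
      winding≡2 : height (rise 1) L ≡ + 2
      winding≡2 = trans (winding-rise 1 L 1≤L) (cong (λ b → + 1 ℤ.+ bit b) L-1-odd)

    split-step : ∀ k → Reaches 1 (Power k) (Copies n (Power k))
    split-step k with parity (cycle-length k) in L-parity
    ... | false = label dir (rise 0) , ⊗label≅Copies dir (rise 0)
                    (≡ₙ-reflexive (trans (winding-rise 0 L ℕ.z≤n) (cong (λ b → + 0 ℤ.+ bit b) L-parity)))
      where
      open Layer k
      L = cycle-length k
    ... | true  = label dir (rise n) , ⊗label≅Copies dir (rise n) (≡ₙ-trans (≡ₙ-reflexive winding≡n) n≡ₙ0)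
      where
      open Layer k
      L = cycle-length k
      n≤L : n ≤ L
      n≤L = ℕP.≤-trans (m%2≡1⇒n≤m (parity⇒%2≡1 m (trans (sym (parity-cycle-length k)) L-parity)))
                       (m≤cycle-length k)
      L-n-even : parity (L ∸ n) ≡ false
      L-n-even with parity (L ∸ n) | parity-∸ n L n≤L
      ... | false | _ = refl
      ... | true  | e with () ← trans (cong (_xor true) (sym n-odd)) (trans e L-parity)
      winding≡n : height (rise n) L ≡ + n
      winding≡n = trans (winding-rise n L n≤L) (trans (cong (λ b → + n ℤ.+ bit b) L-n-even) (ℤP.+-identityʳ (+ n)))

    private instance
      m-nonZero : NonZero m
      m-nonZero = ℕ.>-nonZero (ℕP.<-≤-trans (ℕ.s≤s ℕ.z≤n) 2≤m)

    cycle-length≡ : ∀ k → cycle-length k ≡ n ^ k * m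
    cycle-length≡ zero    = sym (ℕP.*-identityˡ m)
    cycle-length≡ (suc k) = trans (cong (n *_) (cycle-length≡ k)) (sym (ℕP.*-assoc n (n ^ k) m))

    toℕ-remainder : ∀ a b .{{_ : NonZero b}} (i : Fin (a * b)) → toℕ (F.remainder {a} b i) ≡ toℕ i % b
    toℕ-remainder a b i = begin
        toℕ r                        ≡⟨ m<n⇒m%n≡m (FP.toℕ<n r) ⟨
        toℕ r % b                    ≡⟨ [m+kn]%n≡m%n (toℕ r) (toℕ q) b ⟨
        (toℕ r + toℕ q * b) % b      ≡⟨ cong (_% b) (swap (toℕ r) (toℕ q) b) ⟩
        (b * toℕ q + toℕ r) % b      ≡⟨ cong (_% b) (FP.toℕ-combine q r) ⟨
        toℕ (F.combine q r) % b      ≡⟨ cong (λ j → toℕ j % b) (FP.combine-remQuot {a} b i) ⟩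
        toℕ i % b                    ∎
      where
      open ≡-Reasoning
      r = F.remainder {a} b i
      q = F.quotient {a} b i
      swap : ∀ r q b → r + q * b ≡ b * q + r
      swap = solve-∀

    toℕ-block : ∀ k i → toℕ (block k i) ≡ toℕ i % m
    toℕ-block zero    i = sym (m<n⇒m%n≡m (FP.toℕ<n i))
    toℕ-block (suc k) i = begin
        toℕ (block k (F.remainder {n} L i)) ≡⟨ toℕ-block k (F.remainder {n} L i) ⟩
        toℕ (F.remainder {n} L i) % m        ≡⟨ cong (_% m) (toℕ-remainder n L i) ⟩
        toℕ i % L % m                        ≡⟨ m∣n⇒o%n%m≡o%m m L (toℕ i) (divides (n ^ k) (cycle-length≡ k)) ⟩
        toℕ i % m                            ∎
      where
      open ≡-Reasoning
      L = cycle-length k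
      instance
        L-nonZero : NonZero L
        L-nonZero = ℕ.>-nonZero (ℕP.<-≤-trans (ℕ.s≤s ℕ.z≤n) (ℕP.≤-trans 2≤m (m≤cycle-length k)))

    Power-und : ∀ k → und (Power k) ≅ᴳ UPow m T (n ^ k)
    Power-und k = Iso-trans (und-cong Power≅D1) (D1-und dir)
      where
      Power≅D1 : Power k ≅ᴰ D1 (n ^ k * m) (λ i → T (F.remainder {n ^ k} m i)) (λ i → O (F.remainder {n ^ k} m i)) dir
      Power≅D1 = D1-cast T O dir (cycle-length≡ k) (block k) (F.remainder {n ^ k} m) λ i →
        FP.toℕ-injective (trans (toℕ-remainder (n ^ k) m (F.cast (cycle-length≡ k) i))
                           (trans (cong (_% m) (FP.toℕ-cast (cycle-length≡ k) i)) (sym (toℕ-block k i))))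

    Target : (ℕ → ℕ) → ℕ → ℕ → Digraph
    Target b s j = ⋃ (Σ (Fin (suc j)) λ i → Fin (b (toℕ i))) (λ p → Power (toℕ (proj₁ p) + s))

    -- Induction on the last step, which splits the q₁ remaining copies of Power s into n·q₁ = b₀ + q₀ and
    -- grows all the others.
    run : ∀ s j (b q : ℕ → ℕ) → (∀ i → i < j → n * q (suc i) ≡ b i + q i) →
          Reaches j (Copies (b j + q j) (Power s)) (Copies (q 0) (Power s) ⊕ Target b s j)
    run s zero b q _ =
      Iso-trans (≡⇒≅ᴰ (cong (λ c → Copies c (Power s)) (ℕP.+-comm (b 0) (q 0))))
        (Iso-trans (Copies-+ (q 0) (b 0) (Power s)) (⊕-cong Iso-refl (Iso-sym (⋃-Fin-one _ _))))
    run s (suc j) b q recurrence =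
      subst (λ r → Reaches r (Copies (b (suc j) + q (suc j)) (Power s)) (Copies (q 0) (Power s) ⊕ Target b s (suc j)))
            (ℕP.+-comm j 1)
            (reaches-trans j (run s j (b ∘ suc) (q ∘ suc) (λ i i<j → recurrence (suc i) (ℕ.s≤s i<j)))
                             (reaches-target 1 last-step regroup))
      where
      Grown = ⋃ (Σ (Fin (suc j)) λ i → Fin (b (suc (toℕ i)))) (λ p → Power (suc (toℕ (proj₁ p) + s)))
      last-step : Reaches 1 (Copies (q 1) (Power s) ⊕ Target (b ∘ suc) s j) (Copies (q 1) (Copies n (Power s)) ⊕ Grown)
      last-step = reaches-⊕ 1 (reaches-Copies 1 (q 1) (split-step s))
                              (reaches-⋃ 1 (≡-dec FP._≟_ FP._≟_) (λ p → grow-step (toℕ (proj₁ p) + s)))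
      q₁n≡q₀+b₀ : q 1 * n ≡ q 0 + b 0
      q₁n≡q₀+b₀ = trans (ℕP.*-comm (q 1) n) (trans (recurrence 0 (ℕ.s≤s ℕ.z≤n)) (ℕP.+-comm (b 0) (q 0)))
      regroup : Copies (q 1) (Copies n (Power s)) ⊕ Grown ≅ᴰ Copies (q 0) (Power s) ⊕ Target b s (suc j)
      regroup =
        Iso-trans (⊕-cong (Iso-trans (Copies-* (q 1) n (Power s))
                            (Iso-trans (≡⇒≅ᴰ (cong (λ c → Copies c (Power s)) q₁n≡q₀+b₀)) (Copies-+ (q 0) (b 0) (Power s))))
                          Iso-refl)
          (Iso-trans (⊕-assoc _ _ _) (⊕-cong Iso-refl (Iso-sym (⋃-Fin-suc (suc j) _ _))))

    grows : ∀ s k → Reaches s (Power k) (Power (s + k))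
    grows zero    k = Iso-refl
    grows (suc s) k =
      reaches-target (suc s) (reaches-trans 1 (grow-step k) (grows s (suc k))) (≡⇒≅ᴰ (cong Power (ℕP.+-suc s k)))

    schedule : ∀ s l (a q : ℕ → ℕ) → q 0 ≡ 0 → a l + q l ≡ n → (∀ i → i < l → n * q (suc i) ≡ a i + q i) →
               Σ (Labelings n (l + s + 1) (Power 0)) λ hs →
                 (stage n (l + s + 1) (Power 0) hs s ≅ᴰ Power s) ×
                 (stage n (l + s + 1) (Power 0) hs (l + s + 1) ≅ᴰ Target a s l)
    schedule s l a q q₀≡0 aₗ+qₗ≡n recurrence =
      subst (λ r → Σ (Labelings n r (Power 0)) λ hs →
                     (stage n r (Power 0) hs s ≅ᴰ Power s) × (stage n r (Power 0) hs r ≅ᴰ Target a s l))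
            (trans (trans (ℕP.+-suc s l) (cong suc (ℕP.+-comm s l))) (ℕP.+-comm 1 (l + s)))
            (realise-via s (reaches-target s (grows s 0) (≡⇒≅ᴰ (cong Power (ℕP.+-identityʳ s)))) descent)
      where
      descent : Reaches (suc l) (Power s) (Target a s l)
      descent = reaches-trans 1
        (reaches-target 1 (split-step s) (≡⇒≅ᴰ (cong (λ c → Copies c (Power s)) (sym aₗ+qₗ≡n))))
        (reaches-target l (run s l a q recurrence)
          (Iso-trans (≡⇒≅ᴰ (cong (λ c → Copies c (Power s) ⊕ Target a s l) q₀≡0)) (Copies-zero-⊕ (Power s) (Target a s l))))

    Target-und : ∀ a s l → und (Target a s l) ≅ᴳ
                 DisjUnion (Σ (Fin (suc l)) λ i → Fin (a (toℕ i))) (λ p → UPow m T (n ^ (s + toℕ (proj₁ p))))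
    Target-und a s l = Iso-trans (und-⋃ _ _) (DisjUnion-cong λ p →
      Iso-trans (Power-und (toℕ (proj₁ p) + s))
                (≡⇒≅ᴳ (cong (λ e → UPow m T (n ^ e)) (ℕP.+-comm (toℕ (proj₁ p)) s))))

open import Data.Nat using (ℕ; zero; suc; _+_; _*_; _∸_; _^_; _%_; _≤_; _<_; NonZero)
open import Data.Fin using (Fin; toℕ)
open import Data.Bool using (Bool)
open import Data.Product using (Σ; _×_; _,_; proj₁)
open import Data.Integer using (+_)
open import Data.Rational using (_/_)
open import Relation.Binary.PropositionalEquality using (_≡_)
open DigraphAlgebra using (≅ᴳ⇒≅; Iso-sym; Iso-trans; und-cong)
open HornerRecurrence using (integer-recurrence)
open PowerSequences using (2≤m; module Powers)

theorem3p4 :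
    (l m n s : ℕ) → .{{_ : NonZero n}} →
    1 ≤ m → 3 ≤ n → n % 2 ≡ 1 → (m % 2 ≡ 1 → n ≤ m) →
    (T : Fin m → RootedTree) →
    (O : (j : Fin m) → Orientation (T j)) → (dir : Bool) →
    (a : ℕ → ℕ) →
    (l ≡ 0 → a 0 ≡ n) →
    (1 ≤ l → Σq (suc l) (λ i → divPow (a i) n (l ∸ i)) ≡ (+ n) / 1) →
    (1 ≤ l → (k : ℕ) → k < l →
      Σ ℕ λ z → 1 ≤ z × (Σq (suc k) (λ i → divPow (a i) n (suc k ∸ i)) ≡ (+ z) / 1)) →
    Σ (Labelings n (l + s + 1) (D1 m T O dir)) λ hs →
      (UPow m T (n ^ s) ≅ und (stage n (l + s + 1) (D1 m T O dir) hs s))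
      × (DisjUnion (Σ (Fin (suc l)) λ i → Fin (a (toℕ i)))
                   (λ p → UPow m T (n ^ (s + toℕ (proj₁ p))))
         ≅ und (stage n (l + s + 1) (D1 m T O dir) hs (l + s + 1)))
theorem3p4 l m n s 1≤m 3≤n n%2≡1 m%2≡1⇒n≤m T O dir a l≡0⇒ total partial-integral =
  let q , q₀≡0 , aₗ+qₗ≡n , recurrence = integer-recurrence l n a l≡0⇒ total partial-integral
      hs , grown , final = schedule s l a q q₀≡0 aₗ+qₗ≡n recurrence
  in hs , ≅ᴳ⇒≅ (Iso-sym (Iso-trans (und-cong grown) (Power-und s)))
        , ≅ᴳ⇒≅ (Iso-sym (Iso-trans (und-cong final) (Target-und a s l)))
  where open Powers n m n%2≡1 m%2≡1⇒n≤m (2≤m 3≤n 1≤m m%2≡1⇒n≤m) T O dir
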